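{- Let $\ell$ be a prime and $n\ge4$ an integer. Let $C_n$ be the cyclic group of order $n$, $C_n'=C_n\setminus\{1\}$, and let $K_n=\mathrm{Cay}(C_n,C_n')$ be the complete graph on $n$ vertices. Let $\beta:C_n'\to\mathbb{Z}_\ell$ satisfy conditions (1)–(4) below, let $\alpha=\alpha_\beta$, and let $\mu_n=\mu_\ell(K_n,\alpha)$, $\lambda_n=\lambda_\ell(K_n,\alpha)$. Suppose $\ell\nmid n$ and $\sum_{s\in C_n'}\beta(s)^2\not\equiv0\pmod\ell$. Then $\mu_n=0$ and $\lambda_n=1$.
   Context: For a finite abelian group $G$ and $S\subseteq G$ with $S$ generating $G$, $S=S^{ -1}$, $1\notin S$, $\mathrm{Cay}(G,S)$ has vertices $\{v_g\}$ and a directed edge $e(g_1,g_2)$ from $v_{g_1}$ to $v_{g_2}$ whenever $g_1g_2^{ -1}\in S$ (inverse $e(g_2,g_1)$); each vertex has degree $r=\#S$. Conditions on $\beta:S\to\mathbb{Z}_\ell$: (1) its image generates $\mathbb{Z}_\ell$ as a $\mathbb{Z}_\ell$-module; (2) $\beta(s^{ -1})=-\beta(s)$; (3) $\beta(S)\subseteq\mathbb{Z}$; (4) there exist $m>0$ and $(h_1,\dots,h_m)\in S^m$ with $h_1\cdots h_m\in S$ and $\beta(h_1\cdots h_m)\not\equiv\sum_i\beta(h_i)\pmod\ell$. Voltage: $\alpha(e(g_1,g_2))=\beta(g_1g_2^{ -1})$. Enumerating $G=\{g_1,\dots,g_N\}$, with $\delta_S$ the indicator of $S$ and $(1+T)^b=\sum_k\binom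 bkT^k$, the Iwasawa polynomial is $f_{X,\alpha}(T)=\det\big(r\delta_{ij}-\delta_S(g_ig_j^{ -1})(1+T)^{\beta(g_ig_j^{ -1})}\big)_{i,j}\in\mathbb{Z}_\ell[\![T]\!]$. Write $f_{X,\alpha}(T)=(1+T)^{ -m}T\,g(T)$ with $m\ge0$ minimal such that $g\in\mathbb{Z}_\ell[T]$, and $g=\ell^\mu P u$ with $P$ distinguished and $u\in\mathbb{Z}_\ell[\![T]\!]^\times$ (Weierstrass preparation); $\mu_\ell(X,\alpha):=\mu$, $\lambda_\ell(X,\alpha):=\deg P$. -}

module Defs where

open import Data.Nat as ℕ using (ℕ; zero; suc; NonZero; _≤_; _<_; s≤s; z≤n; >-nonZero)
open import Data.Nat.DivMod using (_mod_)
open import Data.Integer as ℤ using (ℤ; +_; -[1+_])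
open import Data.Integer.Divisibility using () renaming (_∣_ to _∣ℤ_)
open import Data.Fin as Fin using (Fin; toℕ; punchIn)
open import Data.List using (List; []; _∷_)
open import Data.Product using (Σ; _×_; ∃; ∃-syntax)
open import Relation.Nullary using (¬_; does)
open import Relation.Binary.PropositionalEquality using (_≡_; _≢_)
open import Data.Bool using (if_then_else_)
open import Function using (_∘_)

-- Polynomials over ℤ in the variable T, as coefficient lists
-- (constant term first).

Poly : Set
Poly = List ℤ

infixl 6 _+P_
infixl 7 _*P_

_+P_ : Poly → Poly → Poly
[] +P q = q
(a ∷ p) +P [] = a ∷ p
(a ∷ p) +P (b ∷ q) = (a ℤ.+ b) ∷ (p +P q)

scaleP : ℤ → Poly → Poly
scaleP c [] = []
scaleP c (a ∷ p) = (c ℤ.* a) ∷ scaleP c p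

_*P_ : Poly → Poly → Poly
[] *P q = []
(a ∷ p) *P q = scaleP a q +P ((+ 0) ∷ (p *P q))

negP : Poly → Poly
negP = scaleP (ℤ.- (+ 1))

uP : Poly
uP = + 1 ∷ + 1 ∷ []

TP : Poly
TP = + 0 ∷ + 1 ∷ []

powP : Poly → ℕ → Poly
powP p zero = + 1 ∷ []
powP p (suc k) = p *P powP p k

coeff : Poly → ℕ → ℤ
coeff [] i = + 0
coeff (a ∷ p) zero = a
coeff (a ∷ p) (suc i) = coeff p i

-- equality of polynomials (coefficientwise; insensitive to trailing zeros)
_≈P_ : Poly → Poly → Set
p ≈P q = ∀ i → coeff p i ≡ coeff q i

-- Laurent polynomials in (1+T): ⟨ k , p ⟩ represents (1+T)^(-k) · p(T),
-- an element of ℤ[T][(1+T)^(-1)] ⊆ ℤ_ℓ[[T]].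

record Laurent : Set where
  constructor ⟨_,_⟩
  field
    sh  : ℕ
    num : Poly

open Laurent public

_+L_ : Laurent → Laurent → Laurent
⟨ k₁ , p₁ ⟩ +L ⟨ k₂ , p₂ ⟩ = ⟨ k₁ ℕ.+ k₂ , powP uP k₂ *P p₁ +P powP uP k₁ *P p₂ ⟩

_*L_ : Laurent → Laurent → Laurent
⟨ k₁ , p₁ ⟩ *L ⟨ k₂ , p₂ ⟩ = ⟨ k₁ ℕ.+ k₂ , p₁ *P p₂ ⟩

negL : Laurent → Laurent
negL ⟨ k , p ⟩ = ⟨ k , negP p ⟩

constL : ℤ → Laurent
constL c = ⟨ 0 , c ∷ [] ⟩

zeroL oneL : Laurent
zeroL = constL (+ 0)
oneL = constL (+ 1)

uPowL : ℤ → Laurent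
uPowL (+ k) = ⟨ 0 , powP uP k ⟩
uPowL -[1+ k ] = ⟨ suc k , + 1 ∷ [] ⟩

sumL : ∀ {n} → (Fin n → Laurent) → Laurent
sumL {zero} f = zeroL
sumL {suc n} f = f Fin.zero +L sumL (f ∘ Fin.suc)

signL : ℕ → Laurent
signL zero = oneL
signL (suc k) = negL (signL k)

det : ∀ n → (Fin n → Fin n → Laurent) → Laurent
det zero A = oneL
det (suc n) A =
  sumL (λ j → signL (toℕ j) *L (A Fin.zero j *L
                 det n (λ i k → A (Fin.suc i) (punchIn j k))))

sumℤ : ∀ {n} → (Fin n → ℤ) → ℤ
sumℤ {zero} f = + 0
sumℤ {suc n} f = f Fin.zero ℤ.+ sumℤ (f ∘ Fin.suc)

_≡[mod_]_ : ℤ → ℕ → ℤ → Set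
a ≡[mod ℓ ] b = (+ ℓ) ∣ℤ (a ℤ.- b)

-- The cyclic group C_n, written additively on Fin n (identity = 0).

nonZero4 : ∀ {n} → 4 ≤ n → NonZero n
nonZero4 (s≤s _) = _

module Cyc (n : ℕ) {{nz : NonZero n}} where

  e : Fin n
  e = 0 mod n

  _⊕_ : Fin n → Fin n → Fin n
  a ⊕ b = (toℕ a ℕ.+ toℕ b) mod n

  _⊖_ : Fin n → Fin n → Fin n
  a ⊖ b = (toℕ a ℕ.+ (n ℕ.∸ toℕ b)) mod n

  inv : Fin n → Fin n
  inv a = e ⊖ a

  prod : ∀ {m} → (Fin m → Fin n) → Fin n
  prod {zero} h = e
  prod {suc m} h = h Fin.zero ⊕ prod (h ∘ Fin.suc)

  InS : Fin n → Set
  InS s = s ≢ e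

  δS : Fin n → ℤ
  δS s = if does (s Fin.≟ e) then + 0 else + 1

  δ : Fin n → Fin n → ℤ
  δ i j = if does (i Fin.≟ j) then + 1 else + 0

  -- r = #S = n - 1
  r : ℤ
  r = + (n ℕ.∸ 1)

  -- Conditions (1)–(4) on β : S → ℤ_ℓ (with values in ℤ, condition (3));
  -- β is given as a function on all of C_n, only its values on S matter.
  Cond1 : ℕ → (Fin n → ℤ) → Set
  Cond1 ℓ β = ∃[ s ] (InS s × ¬ ((+ ℓ) ∣ℤ β s))

  Cond2 : (Fin n → ℤ) → Set
  Cond2 β = ∀ s → InS s → β (inv s) ≡ ℤ.- β s

  Cond4 : ℕ → (Fin n → ℤ) → Set
  Cond4 ℓ β = Σ ℕ λ m → (0 < m) × Σ (Fin m → Fin n) λ h →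
    (∀ i → InS (h i)) × InS (prod h) ×
    ¬ (β (prod h) ≡[mod ℓ ] sumℤ (λ i → β (h i)))

  sumSqS : (Fin n → ℤ) → ℤ
  sumSqS β = sumℤ (λ s → δS s ℤ.* (β s ℤ.* β s))

  iwasawaMatrix : (Fin n → ℤ) → Fin n → Fin n → Laurent
  iwasawaMatrix β i j =
    constL (r ℤ.* δ i j) +L negL (constL (δS (i ⊖ j)) *L uPowL (β (i ⊖ j)))

  iwasawaF : (Fin n → ℤ) → Laurent
  iwasawaF β = det n (iwasawaMatrix β)

-- f = (1+T)^(-m) · T · g   (with f = (1+T)^(-k) P this means
-- (1+T)^m P = (1+T)^k T g)

Decomp : Laurent → ℕ → Poly → Set
Decomp ⟨ k , P ⟩ m g = (powP uP m *P P) ≈P (powP uP k *P (TP *P g))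

MinDecomp : Laurent → ℕ → Poly → Set
MinDecomp f m g = Decomp f m g × (∀ m' → m' < m → ∀ g' → ¬ Decomp f m' g')

-- μ- and λ-invariants of g (Weierstrass: g = ℓ^μ P u).
-- μ = exponent of the largest power of ℓ dividing all coefficients;
-- λ = degree of the distinguished polynomial P = index of the first
--     coefficient of ℓ^(-μ) g that is a unit in ℤ_ℓ.

IsMu : ℕ → Poly → ℕ → Set
IsMu ℓ g μ = (∀ i → (+ (ℓ ℕ.^ μ)) ∣ℤ coeff g i)
           × ∃[ i ] ¬ ((+ (ℓ ℕ.^ suc μ)) ∣ℤ coeff g i)

IsLambda : ℕ → Poly → ℕ → ℕ → Set
IsLambda ℓ g μ λ' = IsMu ℓ g μ
  × ¬ ((+ (ℓ ℕ.^ suc μ)) ∣ℤ coeff g λ')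
  × (∀ i → i < λ' → (+ (ℓ ℕ.^ suc μ)) ∣ℤ coeff g i)

module Submission where

-- Work in ℤ[ε] = ℤ[T]/(T³), where (1 + T)^b becomes 1 + b ε + (b choose 2) ε². There the
-- matrix of f is the Laplacian n I − J of K_n plus terms in ε, and each of its rows sums to −h ε² with
-- 2h = Σ_{s ∈ S} β(s)², because Σ_{s ∈ S} β(s) = 0 by condition (2). Replacing the first column by the
-- sum of all columns gives f ≡ −h ε² det Q, where Q is n I − J with first column replaced by ones;
-- subtracting that column from the others shows det Q = n^(n−1). Hence f = c T² + O(T³) with
-- c = −h n^(n−1), so g ≡ c T mod T², and ℓ ∤ h n^(n−1) gives μ = 0 and λ = 1.

open import Algebra.Bundles using (CommutativeRing)
open import Algebra.Consequences.Propositional using (comm∧idˡ⇒id; comm∧distrˡ⇒distr)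
open import Algebra.Core using (Op₁; Op₂)
open import Algebra.Morphism.Structures using (IsRingHomomorphism)
open import Algebra.Structures using (IsCommutativeRing)
open import Data.Bool using (if_then_else_)
open import Data.Empty using (⊥-elim)
open import Data.Fin as Fin using (Fin; zero; suc; toℕ; punchIn; punchOut; inject₁)
open import Data.Fin.Permutation using (permutation)
open import Data.Fin.Properties
  using ( suc-injective; 0≢1+n; punchInᵢ≢i; punchIn-injective; punchIn-punchOut; toℕ-inject₁; toℕ-injective
        ; toℕ-fromℕ<; toℕ<n)
open import Data.List using ([]; _∷_)
open import Data.Maybe using (Maybe; just; nothing)
open import Data.Nat as ℕ using (ℕ; zero; suc; NonZero; _∸_; _≤_; _<_)
open import Data.Nat.Divisibility using (_∣_; _∣0; 1∣_; ∣1⇒≡1; ∣n⇒∣m*n)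
open import Data.Nat.DivMod using (_%_; m%n<n; m<n⇒m%n≡m; [m+n]%n≡m%n)
open import Data.Nat.Primality using (Prime; euclidsLemma; ¬prime[1])
import Data.Nat.Properties as ℕ
open import Data.Product using (Σ-syntax; _×_; _,_; proj₁; proj₂)
open import Data.Sum using (inj₁; inj₂)
open import Function using (_∘_)
open import Relation.Binary.Definitions using (tri<; tri≈; tri>)
open import Relation.Binary.PropositionalEquality
open import Relation.Nullary using (¬_; yes; no; does)
import Tactic.RingSolver as RingSolver
import Tactic.RingSolver.Core.AlmostCommutativeRing as ACR

-- Determinants by Laplace expansion along the first row

inject₁≢suc : ∀ {n} (k : Fin n) → inject₁ k ≢ suc k
inject₁≢suc zero    ()
inject₁≢suc (suc k) eq = inject₁≢suc k (suc-injective eq)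

punchIn-inject₁-self : ∀ {n} (k : Fin n) → punchIn (inject₁ k) k ≡ suc k
punchIn-inject₁-self zero = refl
punchIn-inject₁-self (suc k) = cong suc (punchIn-inject₁-self k)

punchIn-suc-self : ∀ {n} (k : Fin n) → punchIn (suc k) k ≡ inject₁ k
punchIn-suc-self zero = refl
punchIn-suc-self (suc k) = cong suc (punchIn-suc-self k)

punchIn-inject₁≡punchIn-suc : ∀ {n} {k l : Fin n} → l ≢ k → punchIn (inject₁ k) l ≡ punchIn (suc k) l
punchIn-inject₁≡punchIn-suc {k = zero}  {zero}  l≢k = ⊥-elim (l≢k refl)
punchIn-inject₁≡punchIn-suc {k = zero}  {suc l} l≢k = refl
punchIn-inject₁≡punchIn-suc {k = suc k} {zero}  l≢k = refl
punchIn-inject₁≡punchIn-suc {k = suc k} {suc l} l≢k = cong suc (punchIn-inject₁≡punchIn-suc (l≢k ∘ cong suc))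

punchIn-adjacent : ∀ {n} (j : Fin (suc (suc n))) (k : Fin (suc n)) → j ≢ inject₁ k → j ≢ suc k →
                   Σ[ k′ ∈ Fin n ] (punchIn j (inject₁ k′) ≡ inject₁ k × punchIn j (suc k′) ≡ suc k)
punchIn-adjacent zero    zero    j≢a _   = ⊥-elim (j≢a refl)
punchIn-adjacent zero    (suc k) _   _   = k , refl , refl
punchIn-adjacent (suc zero) zero _   j≢b = ⊥-elim (j≢b refl)
punchIn-adjacent {suc n} (suc (suc j)) zero _ _ = zero , refl , refl
punchIn-adjacent {suc n} (suc j) (suc k) j≢a j≢b
  with k′ , a≡ , b≡ ← punchIn-adjacent j k (j≢a ∘ cong suc) (j≢b ∘ cong suc)
  = suc k′ , cong suc a≡ , cong suc b≡

module Determinant {ℓ} {A : Set ℓ} {add mul : Op₂ A} {neg : Op₁ A} {zero# one# : A}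
  (isCommutativeRing : IsCommutativeRing _≡_ add mul neg zero# one#) where

  commutativeRing : CommutativeRing ℓ ℓ
  commutativeRing = record { isCommutativeRing = isCommutativeRing }

  open CommutativeRing commutativeRing public using (_+_; _*_; -_; _-_; 0#; 1#; semiring; rawRing)
  open CommutativeRing commutativeRing
    using (ring; commutativeSemiring; +-identityˡ; +-identityʳ; -‿inverseʳ; zeroˡ; zeroʳ; *-identityˡ; *-identityʳ)
  open import Algebra.Properties.Ring ring using (-‿distribˡ-*; +-inverseʳ-unique; -‿injective; -0#≈0#)
  open import Algebra.Properties.Semiring.Sum semiring public using (sum; sum-cong-≗)
  open import Algebra.Properties.Semiring.Sum semiring using (sum-remove; sum-replicate-zero; ∑-distrib-+; *-distribˡ-sum)
  open import Algebra.Properties.Semiring.Exp semiring public using (_^_)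
  open import Algebra.Solver.Ring.NaturalCoefficients.Default commutativeSemiring
    using (solve; _:=_; _:+_; _:*_)
  open ≡-Reasoning

  sum-zero : ∀ {n} {f : Fin n → A} → (∀ j → f j ≡ 0#) → sum f ≡ 0#
  sum-zero {n} f≡0 = trans (sum-cong-≗ f≡0) (sum-replicate-zero n)

  sum-single : ∀ {n} {f : Fin n → A} (c : Fin n) → (∀ j → j ≢ c → f j ≡ 0#) → sum f ≡ f c
  sum-single {suc n} {f} c others = begin
    sum f                    ≡⟨ sum-remove {i = c} f ⟩
    f c + sum (f ∘ punchIn c) ≡⟨ cong (f c +_) (sum-zero (λ k → others (punchIn c k) (punchInᵢ≢i c k))) ⟩
    f c + 0#                 ≡⟨ +-identityʳ (f c) ⟩
    f c                      ∎

  sum-pair : ∀ {n} {f : Fin n → A} {b c : Fin n} → b ≢ c → (∀ j → j ≢ b → j ≢ c → f j ≡ 0#) →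
             sum f ≡ f b + f c
  sum-pair {suc n} {f} {b} {c} b≢c others = begin
    sum f                     ≡⟨ sum-remove {i = b} f ⟩
    f b + sum (f ∘ punchIn b) ≡⟨ cong (f b +_) (sum-single (punchOut b≢c) others′) ⟩
    f b + f (punchIn b (punchOut b≢c)) ≡⟨ cong (λ j → f b + f j) (punchIn-punchOut b≢c) ⟩
    f b + f c                 ∎
    where
    others′ : ∀ k → k ≢ punchOut b≢c → f (punchIn b k) ≡ 0#
    others′ k k≢ = others (punchIn b k) (punchInᵢ≢i b k)
      (λ eq → k≢ (punchIn-injective b k _ (trans eq (sym (punchIn-punchOut b≢c)))))

  Matrix : ℕ → Set ℓ
  Matrix n = Fin n → Fin n → A

  infix 4 _≋_
  _≋_ : ∀ {n} → Matrix n → Matrix n → Set ℓ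
  M ≋ N = ∀ i k → M i k ≡ N i k

  AgreeOff : ∀ {n} → Fin n → Matrix n → Matrix n → Set ℓ
  AgreeOff c M N = ∀ i k → k ≢ c → M i k ≡ N i k

  sign : ℕ → A
  sign zero    = 1#
  sign (suc k) = - sign k

  minor : ∀ {n} → Matrix (suc n) → Fin (suc n) → Matrix n
  minor M j i k = M (suc i) (punchIn j k)

  det : ∀ n → Matrix n → A
  laplaceTerm : ∀ {n} → Matrix (suc n) → Fin (suc n) → A
  det zero    _ = 1#
  det (suc n) M = sum (laplaceTerm M)
  laplaceTerm {n} M j = sign (toℕ j) * (M zero j * det n (minor M j))

  det-cong : ∀ {n} {M N : Matrix n} → M ≋ N → det n M ≡ det n N
  det-cong {zero}  _   = refl
  det-cong {suc n} M≋N = sum-cong-≗ λ j →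
    cong₂ (λ x y → sign (toℕ j) * (x * y)) (M≋N zero j) (det-cong (λ i k → M≋N (suc i) (punchIn j k)))

  minor-≋ : ∀ {n} {c : Fin (suc n)} {M N : Matrix (suc n)} → AgreeOff c M N → minor M c ≋ minor N c
  minor-≋ {c = c} M≈N i k = M≈N (suc i) (punchIn c k) (punchInᵢ≢i c k)

  minor-agreeOff : ∀ {n} {c j : Fin (suc n)} {M N : Matrix (suc n)} (j≢c : j ≢ c) →
                   AgreeOff c M N → AgreeOff (punchOut j≢c) (minor M j) (minor N j)
  minor-agreeOff {j = j} j≢c M≈N i k k≢ = M≈N (suc i) (punchIn j k)
    (λ eq → k≢ (punchIn-injective j k _ (trans eq (sym (punchIn-punchOut j≢c)))))

  det-linear : ∀ {n} (c : Fin n) x y {M N P : Matrix n} → AgreeOff c M P → AgreeOff c N P →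
               (∀ i → P i c ≡ x * M i c + y * N i c) → det n P ≡ x * det n M + y * det n N
  det-linear {suc n} c x y {M} {N} {P} M≈P N≈P Pc = begin
    sum (laplaceTerm P)                                         ≡⟨ sum-cong-≗ term ⟩
    sum (λ j → x * laplaceTerm M j + y * laplaceTerm N j)
      ≡⟨ ∑-distrib-+ (λ j → x * laplaceTerm M j) (λ j → y * laplaceTerm N j) ⟩
    sum (λ j → x * laplaceTerm M j) + sum (λ j → y * laplaceTerm N j)
      ≡⟨ sym (cong₂ _+_ (*-distribˡ-sum x (laplaceTerm M)) (*-distribˡ-sum y (laplaceTerm N))) ⟩
    x * det (suc n) M + y * det (suc n) N                       ∎
    where
    term : ∀ j → laplaceTerm P j ≡ x * laplaceTerm M j + y * laplaceTerm N j
    term j with j Fin.≟ c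
    ... | yes refl = begin
      sign (toℕ j) * (P zero j * det n (minor P j))
        ≡⟨ cong₂ (λ p d → sign (toℕ j) * (p * d)) (Pc zero) (det-cong (λ i k → sym (minor-≋ M≈P i k))) ⟩
      sign (toℕ j) * ((x * M zero j + y * N zero j) * det n (minor M j))
        ≡⟨ solve 6 (λ s x y m p d → s :* ((x :* m :+ y :* p) :* d) := x :* (s :* (m :* d)) :+ y :* (s :* (p :* d))) refl
             (sign (toℕ j)) x y (M zero j) (N zero j) _ ⟩
      x * (sign (toℕ j) * (M zero j * det n (minor M j))) + y * (sign (toℕ j) * (N zero j * det n (minor M j)))
        ≡⟨ cong (λ d → _ + y * (sign (toℕ j) * (N zero j * d)))
             (det-cong (λ i k → trans (minor-≋ N≈P i k) (sym (minor-≋ M≈P i k)))) ⟨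
      x * laplaceTerm M j + y * laplaceTerm N j ∎
    ... | no j≢c = begin
      sign (toℕ j) * (P zero j * det n (minor P j))
        ≡⟨ cong (λ d → sign (toℕ j) * (P zero j * d))
             (det-linear (punchOut j≢c) x y (minor-agreeOff j≢c M≈P) (minor-agreeOff j≢c N≈P)
               (λ i → trans (cong (P (suc i)) (punchIn-punchOut j≢c))
                 (trans (Pc (suc i)) (cong₂ (λ m p → x * m + y * p)
                   (cong (M (suc i)) (sym (punchIn-punchOut j≢c))) (cong (N (suc i)) (sym (punchIn-punchOut j≢c))))))) ⟩
      sign (toℕ j) * (P zero j * (x * det n (minor M j) + y * det n (minor N j)))
        ≡⟨ solve 6 (λ s p x y d e → s :* (p :* (x :* d :+ y :* e)) := x :* (s :* (p :* d)) :+ y :* (s :* (p :* e))) refl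
             (sign (toℕ j)) (P zero j) x y _ _ ⟩
      x * (sign (toℕ j) * (P zero j * det n (minor M j))) + y * (sign (toℕ j) * (P zero j * det n (minor N j)))
        ≡⟨ cong₂ (λ m p → x * (sign (toℕ j) * (m * _)) + y * (sign (toℕ j) * (p * _)))
             (M≈P zero j j≢c) (N≈P zero j j≢c) ⟨
      x * laplaceTerm M j + y * laplaceTerm N j ∎

  det-additive : ∀ {n} (c : Fin n) {M N P : Matrix n} → AgreeOff c M P → AgreeOff c N P →
                 (∀ i → P i c ≡ M i c + N i c) → det n P ≡ det n M + det n N
  det-additive {n} c {M} {N} {P} M≈P N≈P Pc = begin
    det n P                         ≡⟨ det-linear c 1# 1# M≈P N≈P (λ i → trans (Pc i) (sym (1*+1* _ _))) ⟩
    1# * det n M + 1# * det n N     ≡⟨ 1*+1* (det n M) (det n N) ⟩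
    det n M + det n N               ∎
    where
    1*+1* : ∀ x y → 1# * x + 1# * y ≡ x + y
    1*+1* x y = cong₂ _+_ (*-identityˡ x) (*-identityˡ y)

  det-scale-column : ∀ {n} (c : Fin n) x {M N : Matrix n} → AgreeOff c M N →
                     (∀ i → N i c ≡ x * M i c) → det n N ≡ x * det n M
  det-scale-column {n} c x {M} {N} M≈N Nc = begin
    det n N                      ≡⟨ det-linear c x 0# M≈N M≈N (λ i → trans (Nc i) (sym (+0* x _))) ⟩
    x * det n M + 0# * det n M   ≡⟨ +0* x (det n M) ⟩
    x * det n M                  ∎
    where
    +0* : ∀ x y → x * y + 0# * y ≡ x * y
    +0* x y = trans (cong (x * y +_) (zeroˡ y)) (+-identityʳ (x * y))

  det-zero-column : ∀ {n} (c : Fin n) (M : Matrix n) → (∀ i → M i c ≡ 0#) → det n M ≡ 0#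
  det-zero-column c M Mc≡0 = trans
    (det-scale-column c 0# (λ _ _ _ → refl) (λ i → trans (Mc≡0 i) (sym (zeroˡ (M i c)))))
    (zeroˡ _)

  minor-adjacent : ∀ {n} (k : Fin n) {M : Matrix (suc n)} → (∀ i → M i (inject₁ k) ≡ M i (suc k)) →
                   minor M (suc k) ≋ minor M (inject₁ k)
  minor-adjacent k {M} Ma≡Mb i l with l Fin.≟ k
  ... | yes refl = begin
    M (suc i) (punchIn (suc k) k)     ≡⟨ cong (M (suc i)) (punchIn-suc-self k) ⟩
    M (suc i) (inject₁ k)             ≡⟨ Ma≡Mb (suc i) ⟩
    M (suc i) (suc k)                 ≡⟨ cong (M (suc i)) (punchIn-inject₁-self k) ⟨
    M (suc i) (punchIn (inject₁ k) k) ∎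
  ... | no l≢k = cong (M (suc i)) (sym (punchIn-inject₁≡punchIn-suc l≢k))

  det-adjacent-equal : ∀ {n} (k : Fin n) (M : Matrix (suc n)) →
                       (∀ i → M i (inject₁ k) ≡ M i (suc k)) → det (suc n) M ≡ 0#
  det-adjacent-equal {suc n} k M Ma≡Mb = begin
    sum (laplaceTerm M)                               ≡⟨ sum-pair (inject₁≢suc k) others ⟩
    laplaceTerm M (inject₁ k) + laplaceTerm M (suc k) ≡⟨ cong₂ _+_ term-a term-b ⟩
    sign (toℕ k) * X + - sign (toℕ k) * X             ≡⟨ cong (sign (toℕ k) * X +_) (-‿distribˡ-* _ X) ⟨
    sign (toℕ k) * X + - (sign (toℕ k) * X)           ≡⟨ -‿inverseʳ _ ⟩
    0#                                                ∎
    where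
    X = M zero (inject₁ k) * det (suc n) (minor M (inject₁ k))
    term-a : laplaceTerm M (inject₁ k) ≡ sign (toℕ k) * X
    term-a = cong (λ t → sign t * X) (toℕ-inject₁ k)
    term-b : laplaceTerm M (suc k) ≡ - sign (toℕ k) * X
    term-b = cong₂ (λ m d → - sign (toℕ k) * (m * d)) (sym (Ma≡Mb zero)) (det-cong (minor-adjacent k {M} Ma≡Mb))
    others : ∀ j → j ≢ inject₁ k → j ≢ suc k → laplaceTerm M j ≡ 0#
    others j j≢a j≢b with k′ , a≡ , b≡ ← punchIn-adjacent j k j≢a j≢b = begin
      sign (toℕ j) * (M zero j * det (suc n) (minor M j)) ≡⟨ cong (λ d → sign (toℕ j) * (M zero j * d)) minor-zero ⟩
      sign (toℕ j) * (M zero j * 0#)                      ≡⟨ cong (sign (toℕ j) *_) (zeroʳ _) ⟩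
      sign (toℕ j) * 0#                                   ≡⟨ zeroʳ _ ⟩
      0#                                                  ∎
      where
      minor-zero : det (suc n) (minor M j) ≡ 0#
      minor-zero = det-adjacent-equal k′ (minor M j) λ i → begin
        M (suc i) (punchIn j (inject₁ k′)) ≡⟨ cong (M (suc i)) a≡ ⟩
        M (suc i) (inject₁ k)              ≡⟨ Ma≡Mb (suc i) ⟩
        M (suc i) (suc k)                  ≡⟨ cong (M (suc i)) b≡ ⟨
        M (suc i) (punchIn j (suc k′))     ∎

  replaceColumn : ∀ {n} → Fin n → (Fin n → A) → Matrix n → Matrix n
  replaceColumn c v M i k with k Fin.≟ c
  ... | yes _ = v i
  ... | no  _ = M i k

  replaceColumn-at : ∀ {n} (c : Fin n) v M i → replaceColumn c v M i c ≡ v i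
  replaceColumn-at c v M i with c Fin.≟ c
  ... | yes _   = refl
  ... | no  c≢c = ⊥-elim (c≢c refl)

  replaceColumn-agreeOff : ∀ {n} (c : Fin n) v M → AgreeOff c (replaceColumn c v M) M
  replaceColumn-agreeOff c v M i k k≢c with k Fin.≟ c
  ... | yes k≡c = ⊥-elim (k≢c k≡c)
  ... | no  _   = refl

  replaceColumn-agreeOff₂ : ∀ {n} (c : Fin n) v w M → AgreeOff c (replaceColumn c v M) (replaceColumn c w M)
  replaceColumn-agreeOff₂ c v w M i k k≢c =
    trans (replaceColumn-agreeOff c v M i k k≢c) (sym (replaceColumn-agreeOff c w M i k k≢c))

  replaceColumn-cong : ∀ {n} {c : Fin n} c′ v {M N} → AgreeOff c M N →
                       AgreeOff c (replaceColumn c′ v M) (replaceColumn c′ v N)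
  replaceColumn-cong c′ v M≈N i k k≢c with k Fin.≟ c′
  ... | yes _ = refl
  ... | no  _ = M≈N i k k≢c

  replaceColumn-≋ : ∀ {n} {c : Fin n} {v M N} → (∀ i → v i ≡ N i c) → AgreeOff c M N → replaceColumn c v M ≋ N
  replaceColumn-≋ {c = c} vc M≈N i k with k Fin.≟ c
  ... | yes refl = vc i
  ... | no  k≢c  = M≈N i k k≢c

  -- Expanding det with the column pair (u + v, u + v) bilinearly gives det M + det N = 0.
  det-swap-adjacent : ∀ {n} (k : Fin n) {M N : Matrix (suc n)} →
    (∀ i → N i (inject₁ k) ≡ M i (suc k)) → (∀ i → N i (suc k) ≡ M i (inject₁ k)) →
    (∀ i l → l ≢ inject₁ k → l ≢ suc k → N i l ≡ M i l) → det (suc n) N ≡ - det (suc n) M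
  det-swap-adjacent {n} k {M} {N} Na Nb Nl = +-inverseʳ-unique (det _ M) (det _ N) (begin
    det _ M + det _ N                                   ≡⟨ cong₂ _+_ (det-cong (X≋M)) (det-cong X≋N) ⟨
    det _ (X u v) + det _ (X v u)                       ≡⟨ cong₂ _+_ (+-identityˡ _) (+-identityʳ _) ⟨
    (0# + det _ (X u v)) + (det _ (X v u) + 0#)         ≡⟨ cong₂ (λ x y → (x + det _ (X u v)) + (det _ (X v u) + y)) (equal u) (equal v) ⟨
    (det _ (X u u) + det _ (X u v)) + (det _ (X v u) + det _ (X v v))
                                                        ≡⟨ cong₂ _+_ (additive-b u u v) (additive-b v u v) ⟨
    det _ (X u w) + det _ (X v w)                       ≡⟨ additive-a u v w ⟨
    det _ (X w w)                                       ≡⟨ equal w ⟩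
    0#                                                  ∎)
    where
    a b : Fin (suc n)
    a = inject₁ k
    b = suc k
    u v w : Fin (suc n) → A
    u i = M i a
    v i = M i b
    w i = u i + v i
    X : (p q : Fin (suc n) → A) → Matrix (suc n)
    X p q = replaceColumn b q (replaceColumn a p M)
    X-a : ∀ p q i → X p q i a ≡ p i
    X-a p q i = trans (replaceColumn-agreeOff b q _ i a (inject₁≢suc k)) (replaceColumn-at a p M i)
    X-b : ∀ p q i → X p q i b ≡ q i
    X-b p q i = replaceColumn-at b q _ i
    equal : ∀ p → det _ (X p p) ≡ 0#
    equal p = det-adjacent-equal k (X p p) (λ i → trans (X-a p p i) (sym (X-b p p i)))
    additive-a : ∀ p p′ q → det _ (X (λ i → p i + p′ i) q) ≡ det _ (X p q) + det _ (X p′ q)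
    additive-a p p′ q = det-additive a {X p q} {X p′ q}
      (replaceColumn-cong b q (replaceColumn-agreeOff₂ a p _ M))
      (replaceColumn-cong b q (replaceColumn-agreeOff₂ a p′ _ M))
      (λ i → trans (X-a _ q i) (sym (cong₂ _+_ (X-a p q i) (X-a p′ q i))))
    additive-b : ∀ p q q′ → det _ (X p (λ i → q i + q′ i)) ≡ det _ (X p q) + det _ (X p q′)
    additive-b p q q′ = det-additive b {X p q} {X p q′}
      (replaceColumn-agreeOff₂ b q _ _) (replaceColumn-agreeOff₂ b q′ _ _)
      (λ i → trans (X-b p _ i) (sym (cong₂ _+_ (X-b p q i) (X-b p q′ i))))
    X≋M : X u v ≋ M
    X≋M = replaceColumn-≋ (λ _ → refl) (λ i l _ → replaceColumn-≋ (λ _ → refl) (λ _ _ _ → refl) i l)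
    X≋N : X v u ≋ N
    X≋N = replaceColumn-≋ (λ i → sym (Nb i)) inner
      where
      inner : AgreeOff b (replaceColumn a v M) N
      inner i l l≢b with l Fin.≟ a
      ... | yes refl = sym (Na i)
      ... | no  l≢a  = sym (Nl i l l≢a l≢b)

  private
    det-equal-columns-at-distance : ∀ d {n} (b : Fin (suc n)) (k : Fin n) {M : Matrix (suc n)} →
      toℕ k ≡ d ℕ.+ toℕ b → (∀ i → M i b ≡ M i (suc k)) → det (suc n) M ≡ 0#
    det-equal-columns-at-distance zero b k {M} k≡b Mb≡Mc =
      det-adjacent-equal k M (subst (λ b → ∀ i → M i b ≡ M i (suc k)) b≡a Mb≡Mc)
      where
      b≡a : b ≡ inject₁ k
      b≡a = toℕ-injective (trans (sym k≡b) (sym (toℕ-inject₁ k)))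
    det-equal-columns-at-distance (suc d) b (suc k) {M} k≡d+b Mb≡Mc = -‿injective (begin
      - det _ M ≡⟨ swapped ⟨
      det _ N   ≡⟨ det-equal-columns-at-distance d b (inject₁ k) {N} closer Nb≡Na ⟩
      0#        ≡⟨ -0#≈0# ⟨
      - 0#      ∎)
      where
      a c : Fin _
      a = inject₁ (suc k)
      c = suc (suc k)
      N : Matrix _
      N = replaceColumn c (λ i → M i a) (replaceColumn a (λ i → M i c) M)
      Na : ∀ i → N i a ≡ M i c
      Na i = trans (replaceColumn-agreeOff c _ _ i a (inject₁≢suc (suc k))) (replaceColumn-at a _ M i)
      Nl : ∀ i l → l ≢ a → l ≢ c → N i l ≡ M i l
      Nl i l l≢a l≢c = trans (replaceColumn-agreeOff c _ _ i l l≢c) (replaceColumn-agreeOff a _ M i l l≢a)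
      swapped : det _ N ≡ - det _ M
      swapped = det-swap-adjacent (suc k) {M} {N} Na (λ i → replaceColumn-at c _ _ i) Nl
      closer : toℕ (inject₁ k) ≡ d ℕ.+ toℕ b
      closer = trans (toℕ-inject₁ k) (ℕ.suc-injective k≡d+b)
      Nb≡Na : ∀ i → N i b ≡ N i a
      Nb≡Na i = begin
        N i b ≡⟨ Nl i b (λ b≡a → ℕ.m≢1+n+m (toℕ b) (trans (cong toℕ b≡a) (cong suc closer)))
                        (λ b≡c → ℕ.m≢1+n+m (toℕ b) (trans (cong toℕ b≡c) (cong suc k≡d+b))) ⟩
        M i b ≡⟨ Mb≡Mc i ⟩
        M i c ≡⟨ Na i ⟨
        N i a ∎

    det-equal-columns-ordered : ∀ {n} {b c : Fin n} → toℕ b ℕ.< toℕ c → (M : Matrix n) →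
                                (∀ i → M i b ≡ M i c) → det n M ≡ 0#
    det-equal-columns-ordered {b = b} {suc k} (ℕ.s≤s b≤k) M =
      det-equal-columns-at-distance (toℕ k ℕ.∸ toℕ b) b k {M} (sym (ℕ.m∸n+n≡m b≤k))

  det-equal-columns : ∀ {n} {b c : Fin n} → b ≢ c → (M : Matrix n) → (∀ i → M i b ≡ M i c) → det n M ≡ 0#
  det-equal-columns {b = b} {c} b≢c M Mb≡Mc with ℕ.<-cmp (toℕ b) (toℕ c)
  ... | tri< b<c _ _ = det-equal-columns-ordered b<c M Mb≡Mc
  ... | tri≈ _ b≡c _ = ⊥-elim (b≢c (toℕ-injective b≡c))
  ... | tri> _ _ c<b = det-equal-columns-ordered c<b M (sym ∘ Mb≡Mc)

  det-sum-column : ∀ {n} (c : Fin n) {m} (w : Fin m → Fin n → A) {M N : Matrix n} → AgreeOff c M N →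
                   (∀ i → N i c ≡ sum (λ l → w l i)) → det n N ≡ sum (λ l → det n (replaceColumn c (w l) M))
  det-sum-column c {zero}  w {N = N} M≈N Nc = det-zero-column c N Nc
  det-sum-column {n} c {suc m} w {M} {N} M≈N Nc = begin
    det n N                                                 ≡⟨ det-additive c {replaceColumn c (w zero) M} {M′}
                                                                 (off-c (w zero)) (off-c rest) Nc′ ⟩
    det n (replaceColumn c (w zero) M) + det n M′           ≡⟨ cong (det n (replaceColumn c (w zero) M) +_) (det-sum-column c (w ∘ suc)
                                                                 (λ i k k≢c → sym (replaceColumn-agreeOff c rest M i k k≢c))
                                                                 (replaceColumn-at c rest M)) ⟩
    sum (λ l → det n (replaceColumn c (w l) M))             ∎
    where
    rest : Fin n → A
    rest i = sum (λ l → w (suc l) i)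
    M′ = replaceColumn c rest M
    off-c : ∀ v → AgreeOff c (replaceColumn c v M) N
    off-c v i k k≢c = trans (replaceColumn-agreeOff c v M i k k≢c) (M≈N i k k≢c)
    Nc′ : ∀ i → N i c ≡ replaceColumn c (w zero) M i c + M′ i c
    Nc′ i = trans (Nc i) (sym (cong₂ _+_ (replaceColumn-at c _ M i) (replaceColumn-at c rest M i)))

  det-column-combination : ∀ {n} (c : Fin n) (coef : Fin n → A) {M N : Matrix n} → AgreeOff c M N →
                           (∀ i → N i c ≡ sum (λ l → coef l * M i l)) → det n N ≡ coef c * det n M
  det-column-combination {n} c coef {M} {N} M≈N Nc = begin
    det n N                                                      ≡⟨ det-sum-column c (λ l i → coef l * M i l) M≈N Nc ⟩
    sum (λ l → det n (replaceColumn c (λ i → coef l * M i l) M)) ≡⟨ sum-single c others ⟩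
    det n (replaceColumn c (λ i → coef c * M i c) M)             ≡⟨ scaled c ⟩
    coef c * det n (replaceColumn c (λ i → M i c) M)             ≡⟨ cong (coef c *_) (det-cong unchanged) ⟩
    coef c * det n M                                             ∎
    where
    scaled : ∀ l → det n (replaceColumn c (λ i → coef l * M i l) M) ≡ coef l * det n (replaceColumn c (λ i → M i l) M)
    scaled l = det-scale-column c (coef l) (replaceColumn-agreeOff₂ c _ _ M)
      (λ i → trans (replaceColumn-at c _ M i) (cong (coef l *_) (sym (replaceColumn-at c _ M i))))
    unchanged : replaceColumn c (λ i → M i c) M ≋ M
    unchanged = replaceColumn-≋ (λ _ → refl) (λ _ _ _ → refl)
    others : ∀ l → l ≢ c → det n (replaceColumn c (λ i → coef l * M i l) M) ≡ 0#
    others l l≢c = begin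
      det n (replaceColumn c (λ i → coef l * M i l) M) ≡⟨ scaled l ⟩
      coef l * det n (replaceColumn c (λ i → M i l) M) ≡⟨ cong (coef l *_) (det-equal-columns (l≢c ∘ sym) _
                                                            (λ i → trans (replaceColumn-at c _ M i)
                                                              (sym (replaceColumn-agreeOff c _ M i l l≢c)))) ⟩
      coef l * 0#                                      ≡⟨ zeroʳ (coef l) ⟩
      0#                                               ∎

  det-add-column-multiple : ∀ {n} {c c′ : Fin n} → c′ ≢ c → ∀ t {M N : Matrix n} → AgreeOff c M N →
                            (∀ i → N i c ≡ M i c + t * M i c′) → det n N ≡ det n M
  det-add-column-multiple {n} {c} {c′} c′≢c t {M} {N} M≈N Nc = begin
    det n N                          ≡⟨ det-linear c 1# t M≈N M′≈N
                                          (λ i → trans (Nc i) (cong₂ _+_ (sym (*-identityˡ _))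
                                            (cong (t *_) (sym (replaceColumn-at c _ M i))))) ⟩
    1# * det n M + t * det n M′      ≡⟨ cong₂ _+_ (*-identityˡ _) (trans (cong (t *_) M′-singular) (zeroʳ t)) ⟩
    det n M + 0#                     ≡⟨ +-identityʳ _ ⟩
    det n M                          ∎
    where
    M′ = replaceColumn c (λ i → M i c′) M
    M′≈N : AgreeOff c M′ N
    M′≈N i k k≢c = trans (replaceColumn-agreeOff c _ M i k k≢c) (M≈N i k k≢c)
    M′-singular : det n M′ ≡ 0#
    M′-singular = det-equal-columns (c′≢c ∘ sym) M′
      (λ i → trans (replaceColumn-at c _ M i) (sym (replaceColumn-agreeOff c _ M i c′ c′≢c)))

  δ : ∀ {n} → Fin n → Fin n → A
  δ i j = if does (i Fin.≟ j) then 1# else 0#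

  δ-refl : ∀ {n} (i : Fin n) → δ i i ≡ 1#
  δ-refl i with i Fin.≟ i
  ... | yes _   = refl
  ... | no  i≢i = ⊥-elim (i≢i refl)

  δ-≢ : ∀ {n} {i j : Fin n} → i ≢ j → δ i j ≡ 0#
  δ-≢ {i = i} {j} i≢j with i Fin.≟ j
  ... | yes i≡j = ⊥-elim (i≢j i≡j)
  ... | no  _   = refl

  det-first-row : ∀ {n} (M : Matrix (suc n)) → (∀ k → M zero (suc k) ≡ 0#) →
                  det (suc n) M ≡ M zero zero * det n (minor M zero)
  det-first-row {n} M row = trans (sum-single zero others) (*-identityˡ _)
    where
    others : ∀ j → j ≢ zero → laplaceTerm M j ≡ 0#
    others zero    0≢0 = ⊥-elim (0≢0 refl)
    others (suc k) _   = begin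
      sign (suc (toℕ k)) * (M zero (suc k) * det n (minor M (suc k)))
        ≡⟨ cong (λ m → sign (suc (toℕ k)) * (m * det n (minor M (suc k)))) (row k) ⟩
      sign (suc (toℕ k)) * (0# * det n (minor M (suc k)))             ≡⟨ cong (sign (suc (toℕ k)) *_) (zeroˡ _) ⟩
      sign (suc (toℕ k)) * 0#                                         ≡⟨ zeroʳ _ ⟩
      0#                                                              ∎

  det-scalar : ∀ n x → det n (λ i k → x * δ i k) ≡ x ^ n
  det-scalar zero    x = refl
  det-scalar (suc n) x = begin
    det (suc n) (λ i k → x * δ i k)      ≡⟨ det-first-row {n} (λ i k → x * δ i k) (λ _ → zeroʳ x) ⟩
    x * 1# * det n (λ i k → x * δ i k)   ≡⟨ cong₂ _*_ (*-identityʳ x) (det-scalar n x) ⟩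
    x * x ^ n                            ∎

  det-add-first-column : ∀ {n} (t : Fin n → A) (M N : Matrix (suc n)) →
    (∀ i → N i zero ≡ M i zero) → (∀ i k → N i (suc k) ≡ M i (suc k) + t k * M i zero) →
    det (suc n) N ≡ det (suc n) M
  det-add-first-column {n} t M N N0 Nk = after-steps (λ k → k) t N N0 (λ i k →
    trans (Nk i k) (cong (λ x → M i (suc k) + x * M i zero) (sym (sum-δ k))))
    where
    sum-δ : ∀ k → sum (λ l → δ l k * t l) ≡ t k
    sum-δ k = begin
      sum (λ l → δ l k * t l) ≡⟨ sum-single k (λ l l≢k → trans (cong (_* t l) (δ-≢ l≢k)) (zeroˡ (t l))) ⟩
      δ k k * t k             ≡⟨ cong (_* t k) (δ-refl k) ⟩
      1# * t k                ≡⟨ *-identityˡ (t k) ⟩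
      t k                     ∎
    -- Step l of the m column operations adds s l times the first column to column suc (ρ l).
    after-steps : ∀ {m} (ρ : Fin m → Fin n) (s : Fin m → A) (N : Matrix (suc n)) → (∀ i → N i zero ≡ M i zero) →
      (∀ i k → N i (suc k) ≡ M i (suc k) + sum (λ l → δ (ρ l) k * s l) * M i zero) → det (suc n) N ≡ det (suc n) M
    after-steps {zero} ρ s N N0 Nk = det-cong {M = N} {N = M} λ where
      i zero    → N0 i
      i (suc k) → trans (Nk i k) (trans (cong (M i (suc k) +_) (zeroˡ (M i zero))) (+-identityʳ _))
    after-steps {suc m} ρ s N N0 Nk =
      trans (det-add-column-multiple (0≢1+n {i = ρ zero}) (s zero) {N′} {N} N′≈N new-column)
            (after-steps (ρ ∘ suc) (s ∘ suc) N′ (λ _ → refl) (λ _ _ → refl))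
      where
      rest : Fin n → A
      rest k = sum (λ l → δ (ρ (suc l)) k * s (suc l))
      N′ : Matrix (suc n)
      N′ i zero    = M i zero
      N′ i (suc k) = M i (suc k) + rest k * M i zero
      N′≈N : AgreeOff (suc (ρ zero)) N′ N
      N′≈N i zero    _    = sym (N0 i)
      N′≈N i (suc k) k≢ρ₀ = sym (begin
        N i (suc k)                                                  ≡⟨ Nk i k ⟩
        M i (suc k) + (δ (ρ zero) k * s zero + rest k) * M i zero     ≡⟨ cong (λ d → M i (suc k) + (d * s zero + rest k) * M i zero)
                                                                          (δ-≢ (k≢ρ₀ ∘ cong suc ∘ sym)) ⟩
        M i (suc k) + (0# * s zero + rest k) * M i zero               ≡⟨ cong (λ d → M i (suc k) + (d + rest k) * M i zero) (zeroˡ (s zero)) ⟩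
        M i (suc k) + (0# + rest k) * M i zero                        ≡⟨ cong (λ d → M i (suc k) + d * M i zero) (+-identityˡ (rest k)) ⟩
        M i (suc k) + rest k * M i zero                               ∎)
      new-column : ∀ i → N i (suc (ρ zero)) ≡ N′ i (suc (ρ zero)) + s zero * N′ i zero
      new-column i = begin
        N i (suc (ρ zero))                                               ≡⟨ Nk i (ρ zero) ⟩
        M i (suc (ρ zero)) + (δ (ρ zero) (ρ zero) * s zero + rest (ρ zero)) * M i zero
                                                                         ≡⟨ cong (λ d → M i (suc (ρ zero)) + (d * s zero + rest (ρ zero)) * M i zero)
                                                                              (δ-refl (ρ zero)) ⟩
        M i (suc (ρ zero)) + (1# * s zero + rest (ρ zero)) * M i zero     ≡⟨ cong (λ d → M i (suc (ρ zero)) + (d + rest (ρ zero)) * M i zero)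
                                                                              (*-identityˡ (s zero)) ⟩
        M i (suc (ρ zero)) + (s zero + rest (ρ zero)) * M i zero          ≡⟨ solve 4 (λ a s r m → a :+ (s :+ r) :* m := a :+ r :* m :+ s :* m) refl
                                                                              (M i (suc (ρ zero))) (s zero) (rest (ρ zero)) (M i zero) ⟩
        M i (suc (ρ zero)) + rest (ρ zero) * M i zero + s zero * M i zero ∎

  det-ones-column : ∀ {n} x (N : Matrix (suc n)) → (∀ i → N i zero ≡ 1#) →
                    (∀ i k → N i (suc k) ≡ x * δ i (suc k) - 1#) → det (suc n) N ≡ x ^ n
  det-ones-column {n} x N N0 Nk = begin
    det (suc n) N                  ≡⟨ det-add-first-column (λ _ → - 1#) T N N0 (λ i k →
                                        trans (Nk i k) (cong (x * δ i (suc k) +_) (sym (*-identityʳ (- 1#))))) ⟩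
    det (suc n) T                  ≡⟨ det-first-row T (λ _ → zeroʳ x) ⟩
    1# * det n (λ i k → x * δ i k) ≡⟨ *-identityˡ _ ⟩
    det n (λ i k → x * δ i k)      ≡⟨ det-scalar n x ⟩
    x ^ n                          ∎
    where
    T : Matrix (suc n)
    T i zero    = 1#
    T i (suc k) = x * δ i (suc k)

module _ {a b} {A : Set a} {B : Set b}
         {add₁ mul₁ : Op₂ A} {neg₁ : Op₁ A} {zero₁ one₁ : A}
         {add₂ mul₂ : Op₂ B} {neg₂ : Op₁ B} {zero₂ one₂ : B}
         (isCommutativeRing₁ : IsCommutativeRing _≡_ add₁ mul₁ neg₁ zero₁ one₁)
         (isCommutativeRing₂ : IsCommutativeRing _≡_ add₂ mul₂ neg₂ zero₂ one₂) where

  private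
    module D₁ = Determinant isCommutativeRing₁
    module D₂ = Determinant isCommutativeRing₂

  det-homomorphic : ∀ {f} → IsRingHomomorphism D₁.rawRing D₂.rawRing f →
                    ∀ n (M : D₁.Matrix n) → f (D₁.det n M) ≡ D₂.det n (λ i k → f (M i k))
  det-homomorphic {f} homo = go
    where
    open IsRingHomomorphism homo using (+-homo; 0#-homo; *-homo; 1#-homo; -‿homo)

    sum-homo : ∀ {n} (g : Fin n → A) → f (D₁.sum g) ≡ D₂.sum (f ∘ g)
    sum-homo {zero}  g = 0#-homo
    sum-homo {suc n} g = trans (+-homo (g zero) (D₁.sum (g ∘ suc))) (cong (D₂._+_ (f (g zero))) (sum-homo (g ∘ suc)))

    sign-homo : ∀ k → f (D₁.sign k) ≡ D₂.sign k
    sign-homo zero    = 1#-homo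
    sign-homo (suc k) = trans (-‿homo (D₁.sign k)) (cong D₂.-_ (sign-homo k))

    go : ∀ n (M : D₁.Matrix n) → f (D₁.det n M) ≡ D₂.det n (λ i k → f (M i k))
    go zero    M = 1#-homo
    go (suc n) M = trans (sum-homo (D₁.laplaceTerm M)) (D₂.sum-cong-≗ λ j → begin
      f (D₁.laplaceTerm M j)
        ≡⟨ *-homo (D₁.sign (toℕ j)) _ ⟩
      f (D₁.sign (toℕ j)) D₂.* f (M zero j D₁.* D₁.det n (D₁.minor M j))
        ≡⟨ cong₂ D₂._*_ (sign-homo (toℕ j)) (trans (*-homo (M zero j) _) (cong (f (M zero j) D₂.*_) (go n (D₁.minor M j)))) ⟩
      D₂.laplaceTerm (λ i k → f (M i k)) j ∎)
      where open ≡-Reasoning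

open import Defs
open import Data.Integer as ℤ using (ℤ; +_; -[1+_]; 0ℤ; 1ℤ)
import Data.Integer.Properties as ℤ
import Data.Integer.Tactic.RingSolver as ℤ-Solver
open import Algebra.Properties.Semiring.Sum ℤ.+-*-semiring
  using (sum; sum-cong-≗; ∑-distrib-+; *-distribˡ-sum; sum-permute)

module ℤ-Det = Determinant ℤ.+-*-isCommutativeRing

sumℤ≡sum : ∀ {n} (f : Fin n → ℤ) → sumℤ f ≡ sum f
sumℤ≡sum {zero}  f = refl
sumℤ≡sum {suc n} f = cong (λ y → f zero ℤ.+ y) (sumℤ≡sum (f ∘ suc))

sum-neg : ∀ {n} (f : Fin n → ℤ) → sum (λ l → ℤ.- f l) ≡ ℤ.- sum f
sum-neg {zero}  f = refl
sum-neg {suc n} f = trans (cong (λ y → ℤ.- f zero ℤ.+ y) (sum-neg (f ∘ suc))) (sym (ℤ.neg-distrib-+ (f zero) (sum (f ∘ suc))))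

pos-^ : ∀ n k → + (n ℕ.^ k) ≡ (+ n) ℤ-Det.^ k
pos-^ n zero    = refl
pos-^ n (suc k) = trans (ℤ.pos-* n (n ℕ.^ k)) (cong (λ y → + n ℤ.* y) (pos-^ n k))

x≡-x⇒x≡0 : ∀ {x} → x ≡ ℤ.- x → x ≡ 0ℤ
x≡-x⇒x≡0 {x} x≡-x = ℤ.*-cancelˡ-≡ (+ 2) x 0ℤ (begin
  + 2 ℤ.* x   ≡⟨ double x ⟩
  x ℤ.+ x     ≡⟨ cong (λ y → x ℤ.+ y) x≡-x ⟩
  x ℤ.- x     ≡⟨ ℤ.+-inverseʳ x ⟩
  0ℤ          ≡⟨ ℤ.*-zeroʳ (+ 2) ⟨
  + 2 ℤ.* 0ℤ  ∎)
  where
  open ≡-Reasoning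
  double : ∀ x → + 2 ℤ.* x ≡ x ℤ.+ x
  double = ℤ-Solver.solve-∀

-- The ring ℤ[ε] = ℤ[T]/(T³)

record ℤ[ε] : Set where
  constructor jet
  field
    c₀ c₁ c₂ : ℤ

open ℤ[ε]

infixl 6 _+ε_
infixl 7 _*ε_
infix  8 -ε_

_+ε_ : Op₂ ℤ[ε]
jet a b c +ε jet a′ b′ c′ = jet (a ℤ.+ a′) (b ℤ.+ b′) (c ℤ.+ c′)

_*ε_ : Op₂ ℤ[ε]
jet a b c *ε jet a′ b′ c′ = jet (a ℤ.* a′) (a ℤ.* b′ ℤ.+ b ℤ.* a′) (a ℤ.* c′ ℤ.+ b ℤ.* b′ ℤ.+ c ℤ.* a′)

-ε_ : Op₁ ℤ[ε]
-ε jet a b c = jet (ℤ.- a) (ℤ.- b) (ℤ.- c)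

ι : ℤ → ℤ[ε]
ι a = jet a 0ℤ 0ℤ

0ε 1ε ε : ℤ[ε]
0ε = ι 0ℤ
1ε = ι 1ℤ
ε  = jet 0ℤ 1ℤ 0ℤ

jet-≡ : ∀ {a b c a′ b′ c′} → a ≡ a′ → b ≡ b′ → c ≡ c′ → jet a b c ≡ jet a′ b′ c′
jet-≡ refl refl refl = refl

ι-* : ∀ a b → ι (a ℤ.* b) ≡ ι a *ε ι b
ι-* a b = jet-≡ refl (sym (c₁-zero a b)) (sym (c₂-zero a b))
  where
  c₁-zero : ∀ a b → a ℤ.* 0ℤ ℤ.+ 0ℤ ℤ.* b ≡ 0ℤ
  c₁-zero = ℤ-Solver.solve-∀
  c₂-zero : ∀ a b → a ℤ.* 0ℤ ℤ.+ 0ℤ ℤ.* 0ℤ ℤ.+ 0ℤ ℤ.* b ≡ 0ℤ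
  c₂-zero = ℤ-Solver.solve-∀

ℤ[ε]-isCommutativeRing : IsCommutativeRing _≡_ _+ε_ _*ε_ -ε_ 0ε 1ε
ℤ[ε]-isCommutativeRing = record
  { isRing = record
    { +-isAbelianGroup = record
      { isGroup = record
        { isMonoid = record
          { isSemigroup = record
            { isMagma = record { isEquivalence = isEquivalence ; ∙-cong = cong₂ _+ε_ }
            ; assoc   = λ where
                (jet a b c) (jet d e f) (jet g h i) → jet-≡ (ℤ.+-assoc a d g) (ℤ.+-assoc b e h) (ℤ.+-assoc c f i)
            }
          ; identity = (λ where (jet a b c) → jet-≡ (ℤ.+-identityˡ a) (ℤ.+-identityˡ b) (ℤ.+-identityˡ c))
                     , (λ where (jet a b c) → jet-≡ (ℤ.+-identityʳ a) (ℤ.+-identityʳ b) (ℤ.+-identityʳ c))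
          }
        ; inverse = (λ where (jet a b c) → jet-≡ (ℤ.+-inverseˡ a) (ℤ.+-inverseˡ b) (ℤ.+-inverseˡ c))
                  , (λ where (jet a b c) → jet-≡ (ℤ.+-inverseʳ a) (ℤ.+-inverseʳ b) (ℤ.+-inverseʳ c))
        ; ⁻¹-cong = cong -ε_
        }
      ; comm = λ where (jet a b c) (jet d e f) → jet-≡ (ℤ.+-comm a d) (ℤ.+-comm b e) (ℤ.+-comm c f)
      }
    ; *-cong     = cong₂ _*ε_
    ; *-assoc    = λ where
        (jet a b c) (jet d e f) (jet g h i) → jet-≡ (ℤ.*-assoc a d g) (assoc₁ a b d e g h) (assoc₂ a b c d e f g h i)
    ; *-identity = comm∧idˡ⇒id *-comm λ where (jet a b c) → jet-≡ (ℤ.*-identityˡ a) (identityˡ₁ a b) (identityˡ₂ a b c)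
    ; distrib    = comm∧distrˡ⇒distr (cong₂ _+ε_) *-comm λ where
        (jet a b c) (jet d e f) (jet g h i) → jet-≡ (ℤ.*-distribˡ-+ a d g) (distribˡ₁ a b d e g h) (distribˡ₂ a b c d e f g h i)
    }
  ; *-comm = *-comm
  }
  where
  *-comm : ∀ x y → x *ε y ≡ y *ε x
  *-comm (jet a b c) (jet d e f) = jet-≡ (ℤ.*-comm a d) (comm₁ a b d e) (comm₂ a b c d e f)
    where
    comm₁ : ∀ a b d e → a ℤ.* e ℤ.+ b ℤ.* d ≡ d ℤ.* b ℤ.+ e ℤ.* a
    comm₁ = ℤ-Solver.solve-∀
    comm₂ : ∀ a b c d e f → a ℤ.* f ℤ.+ b ℤ.* e ℤ.+ c ℤ.* d ≡ d ℤ.* c ℤ.+ e ℤ.* b ℤ.+ f ℤ.* a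
    comm₂ = ℤ-Solver.solve-∀
  assoc₁ : ∀ a b d e g h → a ℤ.* d ℤ.* h ℤ.+ (a ℤ.* e ℤ.+ b ℤ.* d) ℤ.* g ≡ a ℤ.* (d ℤ.* h ℤ.+ e ℤ.* g) ℤ.+ b ℤ.* (d ℤ.* g)
  assoc₁ = ℤ-Solver.solve-∀
  assoc₂ : ∀ a b c d e f g h i →
    a ℤ.* d ℤ.* i ℤ.+ (a ℤ.* e ℤ.+ b ℤ.* d) ℤ.* h ℤ.+ (a ℤ.* f ℤ.+ b ℤ.* e ℤ.+ c ℤ.* d) ℤ.* g
    ≡ a ℤ.* (d ℤ.* i ℤ.+ e ℤ.* h ℤ.+ f ℤ.* g) ℤ.+ b ℤ.* (d ℤ.* h ℤ.+ e ℤ.* g) ℤ.+ c ℤ.* (d ℤ.* g)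
  assoc₂ = ℤ-Solver.solve-∀
  identityˡ₁ : ∀ a b → 1ℤ ℤ.* b ℤ.+ 0ℤ ℤ.* a ≡ b
  identityˡ₁ = ℤ-Solver.solve-∀
  identityˡ₂ : ∀ a b c → 1ℤ ℤ.* c ℤ.+ 0ℤ ℤ.* b ℤ.+ 0ℤ ℤ.* a ≡ c
  identityˡ₂ = ℤ-Solver.solve-∀
  distribˡ₁ : ∀ a b d e g h → a ℤ.* (e ℤ.+ h) ℤ.+ b ℤ.* (d ℤ.+ g) ≡ (a ℤ.* e ℤ.+ b ℤ.* d) ℤ.+ (a ℤ.* h ℤ.+ b ℤ.* g)
  distribˡ₁ = ℤ-Solver.solve-∀
  distribˡ₂ : ∀ a b c d e f g h i →
    a ℤ.* (f ℤ.+ i) ℤ.+ b ℤ.* (e ℤ.+ h) ℤ.+ c ℤ.* (d ℤ.+ g)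
    ≡ (a ℤ.* f ℤ.+ b ℤ.* e ℤ.+ c ℤ.* d) ℤ.+ (a ℤ.* i ℤ.+ b ℤ.* h ℤ.+ c ℤ.* g)
  distribˡ₂ = ℤ-Solver.solve-∀

module ℤ[ε]-Det = Determinant ℤ[ε]-isCommutativeRing
open ℤ[ε]-Det using (_^_)
open import Algebra.Properties.Semiring.Exp ℤ[ε]-Det.semiring using (^-homo-*)

private
  0ε≟_ : (x : ℤ[ε]) → Maybe (0ε ≡ x)
  0ε≟ jet a b c with 0ℤ ℤ.≟ a | 0ℤ ℤ.≟ b | 0ℤ ℤ.≟ c
  ... | yes refl | yes refl | yes refl = just refl
  ... | _        | _        | _        = nothing

  ℤ[ε]-ring : ACR.AlmostCommutativeRing _ _
  ℤ[ε]-ring = ACR.fromCommutativeRing ℤ[ε]-Det.commutativeRing 0ε≟_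

sum-jet : ∀ {n} (f : Fin n → ℤ[ε]) → ℤ[ε]-Det.sum f ≡ jet (sum (c₀ ∘ f)) (sum (c₁ ∘ f)) (sum (c₂ ∘ f))
sum-jet {zero}  f = refl
sum-jet {suc n} f = cong (f zero +ε_) (sum-jet (f ∘ suc))

c₀-isRingHomomorphism : IsRingHomomorphism ℤ[ε]-Det.rawRing ℤ-Det.rawRing c₀
c₀-isRingHomomorphism = record
  { isSemiringHomomorphism = record
    { isNearSemiringHomomorphism = record
      { +-isMonoidHomomorphism = record
        { isMagmaHomomorphism = record
          { isRelHomomorphism = record { cong = cong c₀ }
          ; homo = λ _ _ → refl
          }
        ; ε-homo = refl
        }
      ; *-homo = λ _ _ → refl
      }
    ; 1#-homo = refl
    }
  ; -‿homo = λ _ → refl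
  }

ε²-* : ∀ c y → jet 0ℤ 0ℤ c *ε y ≡ jet 0ℤ 0ℤ (c ℤ.* c₀ y)
ε²-* c (jet a b t) = jet-≡ (ℤ.*-zeroˡ a) (zero₁ a b) (zero₂ c a b t)
  where
  zero₁ : ∀ a b → 0ℤ ℤ.* b ℤ.+ 0ℤ ℤ.* a ≡ 0ℤ
  zero₁ = ℤ-Solver.solve-∀
  zero₂ : ∀ c a b t → 0ℤ ℤ.* t ℤ.+ 0ℤ ℤ.* b ℤ.+ c ℤ.* a ≡ c ℤ.* a
  zero₂ = ℤ-Solver.solve-∀

-- Reduction of Laurent polynomials in 1 + T modulo T³

evalPoly : Poly → ℤ[ε]
evalPoly []      = 0ε
evalPoly (a ∷ p) = ι a +ε ε *ε evalPoly p

evalPoly-+P : ∀ p q → evalPoly (p +P q) ≡ evalPoly p +ε evalPoly q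
evalPoly-+P []      q       = sym (identityˡ (evalPoly q))
  where
  identityˡ : ∀ x → 0ε +ε x ≡ x
  identityˡ = RingSolver.solve-∀ ℤ[ε]-ring
evalPoly-+P (a ∷ p) []      = sym (identityʳ (evalPoly (a ∷ p)))
  where
  identityʳ : ∀ x → x +ε 0ε ≡ x
  identityʳ = RingSolver.solve-∀ ℤ[ε]-ring
evalPoly-+P (a ∷ p) (b ∷ q) =
  trans (cong (λ x → ι (a ℤ.+ b) +ε ε *ε x) (evalPoly-+P p q)) (interchange (ι a) (ι b) (evalPoly p) (evalPoly q))
  where
  interchange : ∀ a b x y → (a +ε b) +ε ε *ε (x +ε y) ≡ (a +ε ε *ε x) +ε (b +ε ε *ε y)
  interchange = RingSolver.solve-∀ ℤ[ε]-ring

evalPoly-scaleP : ∀ c p → evalPoly (scaleP c p) ≡ ι c *ε evalPoly p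
evalPoly-scaleP c []      = sym (zeroʳ (ι c))
  where
  zeroʳ : ∀ x → x *ε 0ε ≡ 0ε
  zeroʳ = RingSolver.solve-∀ ℤ[ε]-ring
evalPoly-scaleP c (a ∷ p) = begin
  ι (c ℤ.* a) +ε ε *ε evalPoly (scaleP c p) ≡⟨ cong₂ (λ x y → x +ε ε *ε y) (ι-* c a) (evalPoly-scaleP c p) ⟩
  ι c *ε ι a +ε ε *ε (ι c *ε evalPoly p)    ≡⟨ distrib (ι c) (ι a) (evalPoly p) ⟩
  ι c *ε (ι a +ε ε *ε evalPoly p)           ∎
  where
  open ≡-Reasoning
  distrib : ∀ c a x → c *ε a +ε ε *ε (c *ε x) ≡ c *ε (a +ε ε *ε x)
  distrib = RingSolver.solve-∀ ℤ[ε]-ring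

evalPoly-*P : ∀ p q → evalPoly (p *P q) ≡ evalPoly p *ε evalPoly q
evalPoly-*P []      q = sym (zeroˡ (evalPoly q))
  where
  zeroˡ : ∀ x → 0ε *ε x ≡ 0ε
  zeroˡ = RingSolver.solve-∀ ℤ[ε]-ring
evalPoly-*P (a ∷ p) q = begin
  evalPoly (scaleP a q +P (+ 0 ∷ p *P q))                 ≡⟨ evalPoly-+P (scaleP a q) (+ 0 ∷ p *P q) ⟩
  evalPoly (scaleP a q) +ε (ι (+ 0) +ε ε *ε evalPoly (p *P q))
    ≡⟨ cong₂ (λ x y → x +ε (ι (+ 0) +ε ε *ε y)) (evalPoly-scaleP a q) (evalPoly-*P p q) ⟩
  ι a *ε evalPoly q +ε (ι (+ 0) +ε ε *ε (evalPoly p *ε evalPoly q))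
    ≡⟨ distrib (ι a) (evalPoly p) (evalPoly q) ⟩
  (ι a +ε ε *ε evalPoly p) *ε evalPoly q                   ∎
  where
  open ≡-Reasoning
  distrib : ∀ a x y → a *ε y +ε (ι (+ 0) +ε ε *ε (x *ε y)) ≡ (a +ε ε *ε x) *ε y
  distrib = RingSolver.solve-∀ ℤ[ε]-ring

evalPoly-powP : ∀ p k → evalPoly (powP p k) ≡ evalPoly p ^ k
evalPoly-powP p zero    = refl
evalPoly-powP p (suc k) = trans (evalPoly-*P p (powP p k)) (cong (evalPoly p *ε_) (evalPoly-powP p k))

evalPoly-coeff : ∀ p → evalPoly p ≡ jet (coeff p 0) (coeff p 1) (coeff p 2)
evalPoly-coeff []      = refl
evalPoly-coeff (a ∷ p) = trans (cong (λ x → ι a +ε ε *ε x) (evalPoly-coeff p))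
  (jet-≡ (ℤ.+-identityʳ a) (shift₁ (coeff p 0) (coeff p 1)) (shift₂ (coeff p 0) (coeff p 1) (coeff p 2)))
  where
  shift₁ : ∀ x y → 0ℤ ℤ.+ (0ℤ ℤ.* y ℤ.+ 1ℤ ℤ.* x) ≡ x
  shift₁ = ℤ-Solver.solve-∀
  shift₂ : ∀ x y z → 0ℤ ℤ.+ (0ℤ ℤ.* z ℤ.+ 1ℤ ℤ.* y ℤ.+ 0ℤ ℤ.* x) ≡ y
  shift₂ = ℤ-Solver.solve-∀

[1+ε]⁻¹ : ℤ[ε]
[1+ε]⁻¹ = jet 1ℤ (ℤ.- 1ℤ) 1ℤ

[1+ε]⁻¹^k*[1+ε]^k : ∀ k → [1+ε]⁻¹ ^ k *ε evalPoly uP ^ k ≡ 1ε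
[1+ε]⁻¹^k*[1+ε]^k zero    = refl
[1+ε]⁻¹^k*[1+ε]^k (suc k) = trans (interchange [1+ε]⁻¹ (evalPoly uP) ([1+ε]⁻¹ ^ k) (evalPoly uP ^ k))
                                  (cong (1ε *ε_) ([1+ε]⁻¹^k*[1+ε]^k k))
  where
  interchange : ∀ a b x y → (a *ε x) *ε (b *ε y) ≡ (a *ε b) *ε (x *ε y)
  interchange = RingSolver.solve-∀ ℤ[ε]-ring

eval : Laurent → ℤ[ε]
eval ⟨ k , p ⟩ = [1+ε]⁻¹ ^ k *ε evalPoly p

evalPoly-shift : ∀ k p → evalPoly (powP uP k *P p) ≡ evalPoly uP ^ k *ε evalPoly p
evalPoly-shift k p = trans (evalPoly-*P (powP uP k) p) (cong (_*ε evalPoly p) (evalPoly-powP uP k))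

eval-+L : ∀ x y → eval (x +L y) ≡ eval x +ε eval y
eval-+L ⟨ k₁ , p₁ ⟩ ⟨ k₂ , p₂ ⟩ = begin
  [1+ε]⁻¹ ^ (k₁ ℕ.+ k₂) *ε evalPoly (powP uP k₂ *P p₁ +P powP uP k₁ *P p₂)
    ≡⟨ cong₂ _*ε_ (^-homo-* [1+ε]⁻¹ k₁ k₂)
         (trans (evalPoly-+P (powP uP k₂ *P p₁) (powP uP k₁ *P p₂))
                (cong₂ _+ε_ (evalPoly-shift k₂ p₁) (evalPoly-shift k₁ p₂))) ⟩
  v₁ *ε v₂ *ε (u₂ *ε P₁ +ε u₁ *ε P₂)
    ≡⟨ rearrange v₁ v₂ u₁ u₂ P₁ P₂ ⟩
  v₁ *ε (v₂ *ε u₂) *ε P₁ +ε v₂ *ε (v₁ *ε u₁) *ε P₂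
    ≡⟨ cong₂ (λ a b → v₁ *ε a *ε P₁ +ε v₂ *ε b *ε P₂) ([1+ε]⁻¹^k*[1+ε]^k k₂) ([1+ε]⁻¹^k*[1+ε]^k k₁) ⟩
  v₁ *ε 1ε *ε P₁ +ε v₂ *ε 1ε *ε P₂
    ≡⟨ unit v₁ v₂ P₁ P₂ ⟩
  v₁ *ε P₁ +ε v₂ *ε P₂ ∎
  where
  open ≡-Reasoning
  v₁ = [1+ε]⁻¹ ^ k₁
  v₂ = [1+ε]⁻¹ ^ k₂
  u₁ = evalPoly uP ^ k₁
  u₂ = evalPoly uP ^ k₂
  P₁ = evalPoly p₁
  P₂ = evalPoly p₂
  rearrange : ∀ v₁ v₂ u₁ u₂ P₁ P₂ →
    v₁ *ε v₂ *ε (u₂ *ε P₁ +ε u₁ *ε P₂) ≡ v₁ *ε (v₂ *ε u₂) *ε P₁ +ε v₂ *ε (v₁ *ε u₁) *ε P₂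
  rearrange = RingSolver.solve-∀ ℤ[ε]-ring
  unit : ∀ v₁ v₂ P₁ P₂ → v₁ *ε 1ε *ε P₁ +ε v₂ *ε 1ε *ε P₂ ≡ v₁ *ε P₁ +ε v₂ *ε P₂
  unit = RingSolver.solve-∀ ℤ[ε]-ring

eval-*L : ∀ x y → eval (x *L y) ≡ eval x *ε eval y
eval-*L ⟨ k₁ , p₁ ⟩ ⟨ k₂ , p₂ ⟩ = trans (cong₂ _*ε_ (^-homo-* [1+ε]⁻¹ k₁ k₂) (evalPoly-*P p₁ p₂))
  (interchange ([1+ε]⁻¹ ^ k₁) ([1+ε]⁻¹ ^ k₂) (evalPoly p₁) (evalPoly p₂))
  where
  interchange : ∀ a b x y → a *ε b *ε (x *ε y) ≡ a *ε x *ε (b *ε y)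
  interchange = RingSolver.solve-∀ ℤ[ε]-ring

eval-negL : ∀ x → eval (negL x) ≡ -ε eval x
eval-negL ⟨ k , p ⟩ = trans (cong ([1+ε]⁻¹ ^ k *ε_) (evalPoly-scaleP (ℤ.- (+ 1)) p))
  (negate ([1+ε]⁻¹ ^ k) (evalPoly p))
  where
  negate : ∀ a x → a *ε (ι (ℤ.- (+ 1)) *ε x) ≡ -ε (a *ε x)
  negate = RingSolver.solve-∀ ℤ[ε]-ring

eval-constL : ∀ c → eval (constL c) ≡ ι c
eval-constL c = constant (ι c)
  where
  constant : ∀ a → 1ε *ε (a +ε ε *ε 0ε) ≡ a
  constant = RingSolver.solve-∀ ℤ[ε]-ring

eval-signL : ∀ k → eval (signL k) ≡ ℤ[ε]-Det.sign k
eval-signL zero    = refl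
eval-signL (suc k) = trans (eval-negL (signL k)) (cong -ε_ (eval-signL k))

eval-sumL : ∀ {n} (f : Fin n → Laurent) → eval (sumL f) ≡ ℤ[ε]-Det.sum (eval ∘ f)
eval-sumL {zero}  f = refl
eval-sumL {suc n} f = trans (eval-+L (f zero) (sumL (f ∘ suc))) (cong (eval (f zero) +ε_) (eval-sumL (f ∘ suc)))

eval-det : ∀ n (A : Fin n → Fin n → Laurent) → eval (det n A) ≡ ℤ[ε]-Det.det n (λ i k → eval (A i k))
eval-det zero    A = refl
eval-det (suc n) A = trans (eval-sumL (λ j → signL (toℕ j) *L (A zero j *L det n (λ i k → A (suc i) (punchIn j k)))))
  (ℤ[ε]-Det.sum-cong-≗ λ j → begin
  eval (signL (toℕ j) *L (A zero j *L det n (λ i k → A (suc i) (punchIn j k))))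
    ≡⟨ eval-*L (signL (toℕ j)) _ ⟩
  eval (signL (toℕ j)) *ε eval (A zero j *L det n (λ i k → A (suc i) (punchIn j k)))
    ≡⟨ cong₂ _*ε_ (eval-signL (toℕ j)) (eval-*L (A zero j) _) ⟩
  ℤ[ε]-Det.sign (toℕ j) *ε (eval (A zero j) *ε eval (det n (λ i k → A (suc i) (punchIn j k))))
    ≡⟨ cong (λ d → ℤ[ε]-Det.sign (toℕ j) *ε (eval (A zero j) *ε d)) (eval-det n _) ⟩
  ℤ[ε]-Det.laplaceTerm (λ i k → eval (A i k)) j ∎)
  where open ≡-Reasoning

-- x = 1 + b ε + (b choose 2) ε², the image of (1 + T)^b.
IsBinomial : ℤ → ℤ[ε] → Set
IsBinomial b x = c₀ x ≡ 1ℤ × c₁ x ≡ b × + 2 ℤ.* c₂ x ≡ b ℤ.* b ℤ.- b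

isBinomial-* : ∀ {b b′ x y} → IsBinomial b x → IsBinomial b′ y → IsBinomial (b ℤ.+ b′) (x *ε y)
isBinomial-* {b} {b′} {jet _ _ t} {jet _ _ s} (refl , refl , 2t) (refl , refl , 2s) =
  refl , c₁-sum b b′ , (begin
    + 2 ℤ.* (1ℤ ℤ.* s ℤ.+ b ℤ.* b′ ℤ.+ t ℤ.* 1ℤ)             ≡⟨ expand b b′ s t ⟩
    + 2 ℤ.* s ℤ.+ + 2 ℤ.* t ℤ.+ + 2 ℤ.* b ℤ.* b′             ≡⟨ cong₂ (λ x y → x ℤ.+ y ℤ.+ + 2 ℤ.* b ℤ.* b′) 2s 2t ⟩
    (b′ ℤ.* b′ ℤ.- b′) ℤ.+ (b ℤ.* b ℤ.- b) ℤ.+ + 2 ℤ.* b ℤ.* b′ ≡⟨ square b b′ ⟩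
    (b ℤ.+ b′) ℤ.* (b ℤ.+ b′) ℤ.- (b ℤ.+ b′)                 ∎)
  where
  open ≡-Reasoning
  c₁-sum : ∀ b b′ → 1ℤ ℤ.* b′ ℤ.+ b ℤ.* 1ℤ ≡ b ℤ.+ b′
  c₁-sum = ℤ-Solver.solve-∀
  expand : ∀ b b′ s t → + 2 ℤ.* (1ℤ ℤ.* s ℤ.+ b ℤ.* b′ ℤ.+ t ℤ.* 1ℤ) ≡ + 2 ℤ.* s ℤ.+ + 2 ℤ.* t ℤ.+ + 2 ℤ.* b ℤ.* b′
  expand = ℤ-Solver.solve-∀
  square : ∀ b b′ → (b′ ℤ.* b′ ℤ.- b′) ℤ.+ (b ℤ.* b ℤ.- b) ℤ.+ + 2 ℤ.* b ℤ.* b′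
                    ≡ (b ℤ.+ b′) ℤ.* (b ℤ.+ b′) ℤ.- (b ℤ.+ b′)
  square = ℤ-Solver.solve-∀

[1+ε]^k-isBinomial : ∀ k → IsBinomial (+ k) (evalPoly uP ^ k)
[1+ε]^k-isBinomial zero    = refl , refl , refl
[1+ε]^k-isBinomial (suc k) = isBinomial-* {x = evalPoly uP} {evalPoly uP ^ k} (refl , refl , refl) ([1+ε]^k-isBinomial k)

[1+ε]⁻¹^k-isBinomial : ∀ k → IsBinomial -[1+ k ] ([1+ε]⁻¹ ^ suc k)
[1+ε]⁻¹^k-isBinomial zero    = refl , refl , refl
[1+ε]⁻¹^k-isBinomial (suc k) = isBinomial-* {x = [1+ε]⁻¹} {[1+ε]⁻¹ ^ suc k} (refl , refl , refl) ([1+ε]⁻¹^k-isBinomial k)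

eval-uPowL : ∀ b → IsBinomial b (eval (uPowL b))
eval-uPowL (+ k)    = subst (IsBinomial (+ k)) (sym (trans (*-identityˡ _) (evalPoly-powP uP k))) ([1+ε]^k-isBinomial k)
  where open IsCommutativeRing ℤ[ε]-isCommutativeRing using (*-identityˡ)
eval-uPowL -[1+ k ] = subst (IsBinomial -[1+ k ]) (sym (*-identityʳ _)) ([1+ε]⁻¹^k-isBinomial k)
  where open IsCommutativeRing ℤ[ε]-isCommutativeRing using (*-identityʳ)

evalPoly-≈P : ∀ {p q} → p ≈P q → evalPoly p ≡ evalPoly q
evalPoly-≈P {p} {q} p≈q = trans (evalPoly-coeff p) (trans (jet-≡ (p≈q 0) (p≈q 1) (p≈q 2)) (sym (evalPoly-coeff q)))

unit-*-ε² : ∀ x c → c₀ x ≡ 1ℤ → x *ε jet 0ℤ 0ℤ c ≡ jet 0ℤ 0ℤ c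
unit-*-ε² (jet _ b t) c refl = jet-≡ refl (c₁-zero b) (c₂-same b t c)
  where
  c₁-zero : ∀ b → 1ℤ ℤ.* 0ℤ ℤ.+ b ℤ.* 0ℤ ≡ 0ℤ
  c₁-zero = ℤ-Solver.solve-∀
  c₂-same : ∀ b t c → 1ℤ ℤ.* c ℤ.+ b ℤ.* 0ℤ ℤ.+ t ℤ.* 0ℤ ≡ c
  c₂-same = ℤ-Solver.solve-∀

decomp-coefficients : ∀ f m g c → eval f ≡ jet 0ℤ 0ℤ c → Decomp f m g → coeff g 0 ≡ 0ℤ × coeff g 1 ≡ c
decomp-coefficients ⟨ k , P ⟩ m g c f≡cε² decomp =
  read-off (evalPoly uP ^ k) (proj₁ ([1+ε]^k-isBinomial k)) (coeff g 0) (coeff g 1) (coeff g 2) (begin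
    jet 0ℤ 0ℤ c                                 ≡⟨ unit-*-ε² (evalPoly uP ^ m) c (proj₁ ([1+ε]^k-isBinomial m)) ⟨
    evalPoly uP ^ m *ε jet 0ℤ 0ℤ c              ≡⟨ cong (evalPoly uP ^ m *ε_) P≡cε² ⟨
    evalPoly uP ^ m *ε evalPoly P               ≡⟨ evalPoly-shift m P ⟨
    evalPoly (powP uP m *P P)                   ≡⟨ evalPoly-≈P decomp ⟩
    evalPoly (powP uP k *P (TP *P g))           ≡⟨ evalPoly-shift k (TP *P g) ⟩
    evalPoly uP ^ k *ε evalPoly (TP *P g)
      ≡⟨ cong (evalPoly uP ^ k *ε_) (trans (evalPoly-*P TP g) (cong (ε *ε_) (evalPoly-coeff g))) ⟩
    evalPoly uP ^ k *ε (ε *ε jet (coeff g 0) (coeff g 1) (coeff g 2)) ∎)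
  where
  open ≡-Reasoning
  open IsCommutativeRing ℤ[ε]-isCommutativeRing using (*-identityˡ; *-assoc; *-comm)
  P≡cε² : evalPoly P ≡ jet 0ℤ 0ℤ c
  P≡cε² = begin
    evalPoly P                                          ≡⟨ *-identityˡ (evalPoly P) ⟨
    1ε *ε evalPoly P
      ≡⟨ cong (_*ε evalPoly P) (trans (*-comm (evalPoly uP ^ k) ([1+ε]⁻¹ ^ k)) ([1+ε]⁻¹^k*[1+ε]^k k)) ⟨
    evalPoly uP ^ k *ε [1+ε]⁻¹ ^ k *ε evalPoly P        ≡⟨ *-assoc (evalPoly uP ^ k) ([1+ε]⁻¹ ^ k) (evalPoly P) ⟩
    evalPoly uP ^ k *ε ([1+ε]⁻¹ ^ k *ε evalPoly P)      ≡⟨ cong (evalPoly uP ^ k *ε_) f≡cε² ⟩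
    evalPoly uP ^ k *ε jet 0ℤ 0ℤ c                      ≡⟨ unit-*-ε² (evalPoly uP ^ k) c (proj₁ ([1+ε]^k-isBinomial k)) ⟩
    jet 0ℤ 0ℤ c                                         ∎
  read-off : ∀ x → c₀ x ≡ 1ℤ → ∀ g₀ g₁ g₂ → jet 0ℤ 0ℤ c ≡ x *ε (ε *ε jet g₀ g₁ g₂) → g₀ ≡ 0ℤ × g₁ ≡ c
  read-off (jet _ b t) refl g₀ g₁ g₂ eq = g₀≡0 , sym (begin
    c                  ≡⟨ cong c₂ eq ⟩
    _                  ≡⟨ c₂-value b t g₀ g₁ g₂ ⟩
    g₁ ℤ.+ b ℤ.* g₀    ≡⟨ cong (λ x → g₁ ℤ.+ b ℤ.* x) g₀≡0 ⟩
    g₁ ℤ.+ b ℤ.* 0ℤ    ≡⟨ c₂-drop b g₁ ⟩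
    g₁                 ∎)
    where
    c₂-drop : ∀ b g → g ℤ.+ b ℤ.* 0ℤ ≡ g
    c₂-drop = ℤ-Solver.solve-∀
    c₁-value : ∀ b g₀ g₁ → 1ℤ ℤ.* (0ℤ ℤ.* g₁ ℤ.+ 1ℤ ℤ.* g₀) ℤ.+ b ℤ.* (0ℤ ℤ.* g₀) ≡ g₀
    c₁-value = ℤ-Solver.solve-∀
    c₂-value : ∀ b t g₀ g₁ g₂ →
      1ℤ ℤ.* (0ℤ ℤ.* g₂ ℤ.+ 1ℤ ℤ.* g₁ ℤ.+ 0ℤ ℤ.* g₀) ℤ.+ b ℤ.* (0ℤ ℤ.* g₁ ℤ.+ 1ℤ ℤ.* g₀) ℤ.+ t ℤ.* (0ℤ ℤ.* g₀)
      ≡ g₁ ℤ.+ b ℤ.* g₀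
    c₂-value = ℤ-Solver.solve-∀
    g₀≡0 : g₀ ≡ 0ℤ
    g₀≡0 = sym (trans (cong c₁ eq) (c₁-value b g₀ g₁))

const-minus-binomial : ∀ x d {b y} → IsBinomial b y →
  ι x +ε -ε (ι d *ε y) ≡ jet (x ℤ.- d) (ℤ.- (d ℤ.* b)) (ℤ.- (d ℤ.* c₂ y))
const-minus-binomial x d {b} {jet _ _ t} (refl , refl , _) = jet-≡ (part₀ x d) (part₁ d b) (part₂ d b t)
  where
  part₀ : ∀ x d → x ℤ.+ ℤ.- (d ℤ.* 1ℤ) ≡ x ℤ.- d
  part₀ = ℤ-Solver.solve-∀
  part₁ : ∀ d b → 0ℤ ℤ.+ ℤ.- (d ℤ.* b ℤ.+ 0ℤ ℤ.* 1ℤ) ≡ ℤ.- (d ℤ.* b)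
  part₁ = ℤ-Solver.solve-∀
  part₂ : ∀ d b t → 0ℤ ℤ.+ ℤ.- (d ℤ.* t ℤ.+ 0ℤ ℤ.* b ℤ.+ 0ℤ ℤ.* 1ℤ) ≡ ℤ.- (d ℤ.* t)
  part₂ = ℤ-Solver.solve-∀

-- The cyclic group C_n

module CyclicGroup (n : ℕ) {{_ : NonZero n}} where

  open Cyc n

  toℕ-⊖ : ∀ a b → toℕ (a ⊖ b) ≡ (toℕ a ℕ.+ (n ∸ toℕ b)) % n
  toℕ-⊖ a b = toℕ-fromℕ< (m%n<n (toℕ a ℕ.+ (n ∸ toℕ b)) n)

  toℕ-⊖-≤ : ∀ a b → toℕ b ≤ toℕ a → toℕ (a ⊖ b) ≡ toℕ a ∸ toℕ b
  toℕ-⊖-≤ a b b≤a = begin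
    toℕ (a ⊖ b)                        ≡⟨ toℕ-⊖ a b ⟩
    (toℕ a ℕ.+ (n ∸ toℕ b)) % n        ≡⟨ cong (_% n) (sym (ℕ.+-∸-assoc (toℕ a) (ℕ.<⇒≤ (toℕ<n b)))) ⟩
    (toℕ a ℕ.+ n ∸ toℕ b) % n          ≡⟨ cong (_% n) (ℕ.+-∸-comm n b≤a) ⟩
    (toℕ a ∸ toℕ b ℕ.+ n) % n          ≡⟨ [m+n]%n≡m%n (toℕ a ∸ toℕ b) n ⟩
    (toℕ a ∸ toℕ b) % n                ≡⟨ m<n⇒m%n≡m (ℕ.≤-<-trans (ℕ.m∸n≤m (toℕ a) (toℕ b)) (toℕ<n a)) ⟩
    toℕ a ∸ toℕ b                      ∎
    where open ≡-Reasoning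

  toℕ-⊖-> : ∀ a b → toℕ a < toℕ b → toℕ (a ⊖ b) ≡ toℕ a ℕ.+ (n ∸ toℕ b)
  toℕ-⊖-> a b a<b = trans (toℕ-⊖ a b) (m<n⇒m%n≡m (begin-strict
    toℕ a ℕ.+ (n ∸ toℕ b) <⟨ ℕ.+-monoˡ-< (n ∸ toℕ b) a<b ⟩
    toℕ b ℕ.+ (n ∸ toℕ b) ≡⟨ ℕ.m+[n∸m]≡n (ℕ.<⇒≤ (toℕ<n b)) ⟩
    n                     ∎))
    where open ℕ.≤-Reasoning

  ⊖-involutive : ∀ a b → a ⊖ (a ⊖ b) ≡ b
  ⊖-involutive a b with ℕ.≤-<-connex (toℕ b) (toℕ a)
  ... | inj₁ b≤a = toℕ-injective (begin
    toℕ (a ⊖ (a ⊖ b))        ≡⟨ toℕ-⊖-≤ a (a ⊖ b) (subst (_≤ toℕ a) (sym a-b) (ℕ.m∸n≤m (toℕ a) (toℕ b))) ⟩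
    toℕ a ∸ toℕ (a ⊖ b)      ≡⟨ cong (toℕ a ∸_) a-b ⟩
    toℕ a ∸ (toℕ a ∸ toℕ b)  ≡⟨ ℕ.m∸[m∸n]≡n b≤a ⟩
    toℕ b                    ∎)
    where
    open ≡-Reasoning
    a-b = toℕ-⊖-≤ a b b≤a
  ... | inj₂ a<b = toℕ-injective (begin
    toℕ (a ⊖ (a ⊖ b))                         ≡⟨ toℕ-⊖-> a (a ⊖ b) a<a⊖b ⟩
    toℕ a ℕ.+ (n ∸ toℕ (a ⊖ b))               ≡⟨ cong (λ x → toℕ a ℕ.+ (n ∸ x)) a-b ⟩
    toℕ a ℕ.+ (n ∸ (toℕ a ℕ.+ (n ∸ toℕ b)))   ≡⟨ cong (λ x → toℕ a ℕ.+ (n ∸ x)) (ℕ.+-comm (toℕ a) (n ∸ toℕ b)) ⟩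
    toℕ a ℕ.+ (n ∸ ((n ∸ toℕ b) ℕ.+ toℕ a))   ≡⟨ cong (toℕ a ℕ.+_) (ℕ.∸-+-assoc n (n ∸ toℕ b) (toℕ a)) ⟨
    toℕ a ℕ.+ (n ∸ (n ∸ toℕ b) ∸ toℕ a)       ≡⟨ cong (λ x → toℕ a ℕ.+ (x ∸ toℕ a)) (ℕ.m∸[m∸n]≡n (ℕ.<⇒≤ (toℕ<n b))) ⟩
    toℕ a ℕ.+ (toℕ b ∸ toℕ a)                 ≡⟨ ℕ.m+[n∸m]≡n (ℕ.<⇒≤ a<b) ⟩
    toℕ b                                     ∎)
    where
    open ≡-Reasoning
    a-b = toℕ-⊖-> a b a<b
    a<a⊖b : toℕ a < toℕ (a ⊖ b)
    a<a⊖b = subst (toℕ a <_) (sym a-b) (ℕ.m<m+n (toℕ a) (ℕ.m<n⇒0<n∸m (toℕ<n b)))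

  toℕ-e : toℕ e ≡ 0
  toℕ-e = trans (toℕ-fromℕ< (m%n<n 0 n)) (m<n⇒m%n≡m (ℕ.>-nonZero⁻¹ n))

  ⊖-identityʳ : ∀ a → a ⊖ e ≡ a
  ⊖-identityʳ a = toℕ-injective (trans (toℕ-⊖-≤ a e (subst (_≤ toℕ a) (sym toℕ-e) ℕ.z≤n))
                                       (cong (toℕ a ∸_) toℕ-e))

  ⊖-self : ∀ a → a ⊖ a ≡ e
  ⊖-self a = toℕ-injective (trans (toℕ-⊖-≤ a a ℕ.≤-refl) (trans (ℕ.n∸n≡0 (toℕ a)) (sym toℕ-e)))

  ⊖≡e⇒≡ : ∀ {a b} → a ⊖ b ≡ e → a ≡ b
  ⊖≡e⇒≡ {a} {b} a⊖b≡e = begin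
    a            ≡⟨ ⊖-identityʳ a ⟨
    a ⊖ e        ≡⟨ cong (a ⊖_) a⊖b≡e ⟨
    a ⊖ (a ⊖ b)  ≡⟨ ⊖-involutive a b ⟩
    b            ∎
    where open ≡-Reasoning

  δS-⊖ : ∀ i k → δS (i ⊖ k) ≡ 1ℤ ℤ.- δ i k
  δS-⊖ i k with (i ⊖ k) Fin.≟ e | i Fin.≟ k
  ... | yes _        | yes _    = refl
  ... | yes i⊖k≡e    | no  i≢k  = ⊥-elim (i≢k (⊖≡e⇒≡ i⊖k≡e))
  ... | no  i⊖k≢e    | yes refl = ⊥-elim (i⊖k≢e (⊖-self i))
  ... | no  _        | no  _    = refl

  δS-inv : ∀ s → δS (inv s) ≡ δS s
  δS-inv s with inv s Fin.≟ e | s Fin.≟ e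
  ... | yes _       | yes _    = refl
  ... | yes inv≡e   | no  s≢e  = ⊥-elim (s≢e (sym (⊖≡e⇒≡ inv≡e)))
  ... | no  inv≢e   | yes refl = ⊥-elim (inv≢e (⊖-self e))
  ... | no  _       | no  _    = refl

  sum-⊖ : ∀ i (h : Fin n → ℤ) → sum (λ l → h (i ⊖ l)) ≡ sum h
  sum-⊖ i h = sym (sum-permute h (permutation (i ⊖_) (i ⊖_) (⊖-involutive i) (⊖-involutive i)))

  sum-δS·β≡0 : ∀ {β} → Cond2 β → sum (λ s → δS s ℤ.* β s) ≡ 0ℤ
  sum-δS·β≡0 {β} cond2 = x≡-x⇒x≡0 (begin
    sum (λ s → δS s ℤ.* β s)                ≡⟨ sum-⊖ e (λ s → δS s ℤ.* β s) ⟨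
    sum (λ s → δS (inv s) ℤ.* β (inv s))    ≡⟨ sum-cong-≗ antisymmetric ⟩
    sum (λ s → ℤ.- (δS s ℤ.* β s))          ≡⟨ sum-neg (λ s → δS s ℤ.* β s) ⟩
    ℤ.- sum (λ s → δS s ℤ.* β s)            ∎)
    where
    open ≡-Reasoning
    antisymmetric : ∀ s → δS (inv s) ℤ.* β (inv s) ≡ ℤ.- (δS s ℤ.* β s)
    antisymmetric s rewrite δS-inv s with s Fin.≟ e
    ... | yes _   = refl
    ... | no  s≢e = trans (cong (1ℤ ℤ.*_) (cond2 s s≢e)) (sym (ℤ.neg-distribʳ-* 1ℤ (β s)))

-- The Iwasawa polynomial of K_n modulo T³

module IwasawaJet (m : ℕ) (β : Fin (suc m) → ℤ) (cond2 : Cyc.Cond2 (suc m) β) where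

  open Cyc (suc m)
  open CyclicGroup (suc m)
  open ≡-Reasoning

  edge : Fin (suc m) → ℤ[ε]
  edge s = eval (uPowL (β s))

  halfSumSq : ℤ
  halfSumSq = sum (λ s → δS s ℤ.* c₂ (edge s))

  twice-halfSumSq : + 2 ℤ.* halfSumSq ≡ sumSqS β
  twice-halfSumSq = begin
    + 2 ℤ.* halfSumSq                               ≡⟨ *-distribˡ-sum (+ 2) weight ⟩
    sum (λ s → + 2 ℤ.* weight s)                    ≡⟨ sum-cong-≗ twice-term ⟩
    sum (λ s → square s ℤ.+ ℤ.- linear s)           ≡⟨ ∑-distrib-+ square (λ s → ℤ.- linear s) ⟩
    sum square ℤ.+ sum (λ s → ℤ.- linear s)         ≡⟨ cong (λ y → sum square ℤ.+ y) (sum-neg linear) ⟩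
    sum square ℤ.+ ℤ.- sum linear                   ≡⟨ cong (λ y → sum square ℤ.- y) (sum-δS·β≡0 cond2) ⟩
    sum square ℤ.+ 0ℤ                               ≡⟨ ℤ.+-identityʳ (sum square) ⟩
    sum square                                      ≡⟨ sumℤ≡sum square ⟨
    sumSqS β                                        ∎
    where
    weight square linear : Fin (suc m) → ℤ
    weight s = δS s ℤ.* c₂ (edge s)
    square s = δS s ℤ.* (β s ℤ.* β s)
    linear s = δS s ℤ.* β s
    twice-term : ∀ s → + 2 ℤ.* weight s ≡ square s ℤ.+ ℤ.- linear s
    twice-term s with eval-uPowL (β s)
    ... | _ , _ , 2c₂≡b²-b = begin
      + 2 ℤ.* (δS s ℤ.* c₂ (edge s))           ≡⟨ reassociate (δS s) (c₂ (edge s)) ⟩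
      δS s ℤ.* (+ 2 ℤ.* c₂ (edge s))           ≡⟨ cong (δS s ℤ.*_) 2c₂≡b²-b ⟩
      δS s ℤ.* (β s ℤ.* β s ℤ.- β s)           ≡⟨ distribute (δS s) (β s) ⟩
      δS s ℤ.* (β s ℤ.* β s) ℤ.+ ℤ.- (δS s ℤ.* β s) ∎
      where
      reassociate : ∀ d c → + 2 ℤ.* (d ℤ.* c) ≡ d ℤ.* (+ 2 ℤ.* c)
      reassociate = ℤ-Solver.solve-∀
      distribute : ∀ d b → d ℤ.* (b ℤ.* b ℤ.- b) ≡ d ℤ.* (b ℤ.* b) ℤ.+ ℤ.- (d ℤ.* b)
      distribute = ℤ-Solver.solve-∀

  M : ℤ[ε]-Det.Matrix (suc m)
  M i j = eval (iwasawaMatrix β i j)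

  entry : ∀ i j → M i j ≡ jet (r ℤ.* δ i j ℤ.- δS (i ⊖ j)) (ℤ.- (δS (i ⊖ j) ℤ.* β (i ⊖ j)))
                              (ℤ.- (δS (i ⊖ j) ℤ.* c₂ (edge (i ⊖ j))))
  entry i j = begin
    eval (constL x +L negL (constL d *L uPowL (β s)))
      ≡⟨ eval-+L (constL x) (negL (constL d *L uPowL (β s))) ⟩
    eval (constL x) +ε eval (negL (constL d *L uPowL (β s)))
      ≡⟨ cong₂ _+ε_ (eval-constL x) (trans (eval-negL (constL d *L uPowL (β s)))
           (cong -ε_ (trans (eval-*L (constL d) (uPowL (β s))) (cong (_*ε edge s) (eval-constL d))))) ⟩
    ι x +ε -ε (ι d *ε edge s)
      ≡⟨ const-minus-binomial x d (eval-uPowL (β s)) ⟩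
    jet (x ℤ.- d) (ℤ.- (d ℤ.* β s)) (ℤ.- (d ℤ.* c₂ (edge s))) ∎
    where
    s = i ⊖ j
    x = r ℤ.* δ i j
    d = δS s

  row-sum : ∀ i → ℤ[ε]-Det.sum (M i) ≡ jet 0ℤ 0ℤ (ℤ.- halfSumSq)
  row-sum i = trans (ℤ[ε]-Det.sum-cong-≗ (entry i)) (trans (sum-jet expanded) (jet-≡ c₀-sum c₁-sum c₂-sum))
    where
    expanded : Fin (suc m) → ℤ[ε]
    expanded l = jet (r ℤ.* δ i l ℤ.- δS (i ⊖ l)) (ℤ.- (δS (i ⊖ l) ℤ.* β (i ⊖ l))) (ℤ.- (δS (i ⊖ l) ℤ.* c₂ (edge (i ⊖ l))))
    c₀-sum : sum (λ l → r ℤ.* δ i l ℤ.- δS (i ⊖ l)) ≡ 0ℤ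
    c₀-sum = begin
      sum (λ l → r ℤ.* δ i l ℤ.- δS (i ⊖ l))                   ≡⟨ ∑-distrib-+ (λ l → r ℤ.* δ i l) (λ l → ℤ.- δS (i ⊖ l)) ⟩
      sum (λ l → r ℤ.* δ i l) ℤ.+ sum (λ l → ℤ.- δS (i ⊖ l))
        ≡⟨ cong₂ ℤ._+_ diagonal (trans (sum-neg (λ l → δS (i ⊖ l))) (cong ℤ.-_ (sum-⊖ i δS))) ⟩
      r ℤ.- sum δS                                             ≡⟨ cong (λ y → r ℤ.- y) sum-δS ⟩
      r ℤ.- r                                                  ≡⟨ ℤ.+-inverseʳ r ⟩
      0ℤ                                                       ∎
      where
      diagonal : sum (λ l → r ℤ.* δ i l) ≡ r
      diagonal = begin
        sum (λ l → r ℤ.* δ i l) ≡⟨ *-distribˡ-sum r (δ i) ⟨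
        r ℤ.* sum (δ i)         ≡⟨ cong (r ℤ.*_) (trans (ℤ-Det.sum-single i (λ l l≢i → ℤ-Det.δ-≢ (l≢i ∘ sym)))
                                                        (ℤ-Det.δ-refl i)) ⟩
        r ℤ.* 1ℤ                ≡⟨ ℤ.*-identityʳ r ⟩
        r                       ∎
      -- e reduces to zero, so δS is + 0 followed by m ones.
      sum-δS : sum δS ≡ r
      sum-δS = trans (ℤ.+-identityˡ _) (ones m)
        where
        ones : ∀ k → sum {k} (λ _ → 1ℤ) ≡ + k
        ones zero    = refl
        ones (suc k) = cong (λ y → 1ℤ ℤ.+ y) (ones k)
    c₁-sum : sum (λ l → ℤ.- (δS (i ⊖ l) ℤ.* β (i ⊖ l))) ≡ 0ℤ
    c₁-sum = trans (sum-neg (λ l → δS (i ⊖ l) ℤ.* β (i ⊖ l)))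
                   (cong ℤ.-_ (trans (sum-⊖ i (λ s → δS s ℤ.* β s)) (sum-δS·β≡0 cond2)))
    c₂-sum : sum (λ l → ℤ.- (δS (i ⊖ l) ℤ.* c₂ (edge (i ⊖ l)))) ≡ ℤ.- halfSumSq
    c₂-sum = trans (sum-neg (λ l → δS (i ⊖ l) ℤ.* c₂ (edge (i ⊖ l)))) (cong ℤ.-_ (sum-⊖ i (λ s → δS s ℤ.* c₂ (edge s))))

  eval-iwasawaF : eval (iwasawaF β) ≡ jet 0ℤ 0ℤ (ℤ.- halfSumSq ℤ.* + (suc m ℕ.^ m))
  eval-iwasawaF = begin
    eval (iwasawaF β)                        ≡⟨ eval-det (suc m) (iwasawaMatrix β) ⟩
    ℤ[ε]-Det.det (suc m) M                   ≡⟨ *-identityˡ _ ⟨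
    1ε *ε ℤ[ε]-Det.det (suc m) M             ≡⟨ ℤ[ε]-Det.det-column-combination zero (λ _ → 1ε) M≈rowSums rowSums₀ ⟨
    ℤ[ε]-Det.det (suc m) rowSums             ≡⟨ ℤ[ε]-Det.det-scale-column zero λ₀ ones≈rowSums (λ _ → sym (*-identityʳ λ₀)) ⟩
    λ₀ *ε ℤ[ε]-Det.det (suc m) ones          ≡⟨ ε²-* (ℤ.- halfSumSq) (ℤ[ε]-Det.det (suc m) ones) ⟩
    jet 0ℤ 0ℤ (ℤ.- halfSumSq ℤ.* c₀ (ℤ[ε]-Det.det (suc m) ones))
                                             ≡⟨ cong (λ y → jet 0ℤ 0ℤ (ℤ.- halfSumSq ℤ.* y)) c₀-det ⟩
    jet 0ℤ 0ℤ (ℤ.- halfSumSq ℤ.* + (suc m ℕ.^ m)) ∎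
    where
    open IsCommutativeRing ℤ[ε]-isCommutativeRing using (*-identityˡ; *-identityʳ)
    λ₀ = jet 0ℤ 0ℤ (ℤ.- halfSumSq)
    rowSums ones : ℤ[ε]-Det.Matrix (suc m)
    rowSums i zero    = λ₀
    rowSums i (suc k) = M i (suc k)
    ones i zero    = 1ε
    ones i (suc k) = M i (suc k)
    M≈rowSums : ℤ[ε]-Det.AgreeOff zero M rowSums
    M≈rowSums i zero    0≢0 = ⊥-elim (0≢0 refl)
    M≈rowSums i (suc k) _   = refl
    ones≈rowSums : ℤ[ε]-Det.AgreeOff zero ones rowSums
    ones≈rowSums i zero    0≢0 = ⊥-elim (0≢0 refl)
    ones≈rowSums i (suc k) _   = refl
    rowSums₀ : ∀ i → λ₀ ≡ ℤ[ε]-Det.sum (λ l → 1ε *ε M i l)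
    rowSums₀ i = sym (trans (ℤ[ε]-Det.sum-cong-≗ (λ l → *-identityˡ (M i l))) (row-sum i))
    c₀-det : c₀ (ℤ[ε]-Det.det (suc m) ones) ≡ + (suc m ℕ.^ m)
    c₀-det = begin
      c₀ (ℤ[ε]-Det.det (suc m) ones)
        ≡⟨ det-homomorphic ℤ[ε]-isCommutativeRing ℤ.+-*-isCommutativeRing c₀-isRingHomomorphism (suc m) ones ⟩
      ℤ-Det.det (suc m) (λ i k → c₀ (ones i k))
        ≡⟨ ℤ-Det.det-ones-column (+ suc m) (λ i k → c₀ (ones i k)) (λ _ → refl) laplacian ⟩
      (+ suc m) ℤ-Det.^ m
        ≡⟨ pos-^ (suc m) m ⟨
      + (suc m ℕ.^ m) ∎
      where
      laplacian : ∀ i k → c₀ (M i (suc k)) ≡ + suc m ℤ.* δ i (suc k) ℤ.- 1ℤ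
      laplacian i k = begin
        c₀ (M i (suc k))                              ≡⟨ cong c₀ (entry i (suc k)) ⟩
        r ℤ.* δ i (suc k) ℤ.- δS (i ⊖ suc k)          ≡⟨ cong (λ y → r ℤ.* δ i (suc k) ℤ.- y) (δS-⊖ i (suc k)) ⟩
        r ℤ.* δ i (suc k) ℤ.- (1ℤ ℤ.- δ i (suc k))    ≡⟨ regroup r (δ i (suc k)) ⟩
        (1ℤ ℤ.+ r) ℤ.* δ i (suc k) ℤ.- 1ℤ             ∎
        where
        regroup : ∀ r d → r ℤ.* d ℤ.- (1ℤ ℤ.- d) ≡ (1ℤ ℤ.+ r) ℤ.* d ℤ.- 1ℤ
        regroup = ℤ-Solver.solve-∀

prime∤*^ : ∀ {p a b} → Prime p → ¬ p ∣ a → ¬ p ∣ b → ∀ k → ¬ p ∣ a ℕ.* b ℕ.^ k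
prime∤*^ {p} {a} {b} p-prime p∤a p∤b k p∣a·bᵏ with euclidsLemma a (b ℕ.^ k) p-prime p∣a·bᵏ
... | inj₁ p∣a  = p∤a p∣a
... | inj₂ p∣bᵏ = p∤bᵏ k p∣bᵏ
  where
  p∤bᵏ : ∀ k → ¬ p ∣ b ℕ.^ k
  p∤bᵏ zero    p∣1    = ¬prime[1] (subst Prime (∣1⇒≡1 p∣1) p-prime)
  p∤bᵏ (suc k) p∣b·bᵏ with euclidsLemma b (b ℕ.^ k) p-prime p∣b·bᵏ
  ... | inj₁ p∣b  = p∤b p∣b
  ... | inj₂ p∣bᵏ = p∤bᵏ k p∣bᵏ

ℓ∣g₀∧ℓ∤g₁⇒μ≡0∧λ≡1 : ∀ {ℓ g} → ℓ ∣ ℤ.∣ coeff g 0 ∣ → ¬ ℓ ∣ ℤ.∣ coeff g 1 ∣ →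
                     IsMu ℓ g 0 × IsLambda ℓ g 0 1
ℓ∣g₀∧ℓ∤g₁⇒μ≡0∧λ≡1 {ℓ} {g} ℓ∣g₀ ℓ∤g₁ =
  isMu , isMu , ℓ¹∤g₁ , λ { zero _ → ℓ¹∣g₀ ; (suc _) (ℕ.s≤s ()) }
  where
  ℓ¹∤g₁ : ¬ ℓ ℕ.^ 1 ∣ ℤ.∣ coeff g 1 ∣
  ℓ¹∤g₁ = ℓ∤g₁ ∘ subst (_∣ ℤ.∣ coeff g 1 ∣) (ℕ.*-identityʳ ℓ)
  ℓ¹∣g₀ : ℓ ℕ.^ 1 ∣ ℤ.∣ coeff g 0 ∣
  ℓ¹∣g₀ = subst (_∣ ℤ.∣ coeff g 0 ∣) (sym (ℕ.*-identityʳ ℓ)) ℓ∣g₀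
  isMu : IsMu ℓ g 0
  isMu = (λ _ → 1∣ _) , 1 , ℓ¹∤g₁

theorem4p12 : (ℓ : ℕ) → Prime ℓ → (n : ℕ) → (hn : 4 ≤ n) → (β : Fin n → ℤ) →
    let open Cyc n {{nonZero4 hn}} in
    Cond1 ℓ β → Cond2 β → Cond4 ℓ β →
    ¬ (ℓ ∣ n) →
    ¬ (sumSqS β ≡[mod ℓ ] (+ 0)) →
    (m : ℕ) (g : Poly) → MinDecomp (iwasawaF β) m g →
    IsMu ℓ g 0 × IsLambda ℓ g 0 1
theorem4p12 ℓ ℓ-prime (suc n-1) (ℕ.s≤s _) β _ cond2 _ ℓ∤n ℓ∤Σβ² m g (decomp , _) =
  ℓ∣g₀∧ℓ∤g₁⇒μ≡0∧λ≡1 {g = g} ℓ∣g₀ ℓ∤g₁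
  where
  open IwasawaJet n-1 β cond2
  coefficients = decomp-coefficients (Cyc.iwasawaF (suc n-1) β) m g _ eval-iwasawaF decomp
  ℓ∣g₀ : ℓ ∣ ℤ.∣ coeff g 0 ∣
  ℓ∣g₀ = subst (λ x → ℓ ∣ ℤ.∣ x ∣) (sym (proj₁ coefficients)) (ℓ ∣0)
  ℓ∤halfSumSq : ¬ ℓ ∣ ℤ.∣ halfSumSq ∣
  ℓ∤halfSumSq ℓ∣h = ℓ∤Σβ² (subst (λ x → ℓ ∣ ℤ.∣ x ∣) (trans twice-halfSumSq (sym (ℤ.+-identityʳ _)))
                              (subst (ℓ ∣_) (sym (ℤ.abs-* (+ 2) halfSumSq)) (∣n⇒∣m*n 2 ℓ∣h)))
  ∣g₁∣ : ℤ.∣ coeff g 1 ∣ ≡ ℤ.∣ halfSumSq ∣ ℕ.* suc n-1 ℕ.^ n-1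
  ∣g₁∣ = trans (cong ℤ.∣_∣ (proj₂ coefficients))
               (trans (ℤ.abs-* (ℤ.- halfSumSq) _) (cong (ℕ._* _) (ℤ.∣-i∣≡∣i∣ halfSumSq)))
  ℓ∤g₁ : ¬ ℓ ∣ ℤ.∣ coeff g 1 ∣
  ℓ∤g₁ = prime∤*^ ℓ-prime ℓ∤halfSumSq ℓ∤n n-1 ∘ subst (ℓ ∣_) ∣g₁∣
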